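{- Let $G$ be a tree graph and $(r_1,r_2)$ an edge of $G$. Removing this edge yields two subtrees (induced subgraphs) $G_1$ containing $r_1$ and $G_2$ containing $r_2$. Let $\delta$ be the degree of $r_1$ in $G$, $\delta_1=\delta-1$ its degree in $G_1$, and $\delta_2$ the degree of $r_2$ in $G_2$. Then (1) $n_1(G,r_1) = n_1(G_1,r_1)\cdot\big[2\, n_1(G_2,r_2)+\sum_{j=0}^{\delta_2}(j+2)\, n_0^j(G_2,r_2)\big] + \sum_{i=0}^{\delta_1} n_0^i(G_1,r_1)\cdot\big[(i+1)\, n_1(G_2,r_2) + i\, n_0(G_2,r_2)\big]$; (2) $n_0^0(G,r_1) = n_0^0(G_1,r_1)\cdot\big[n_1(G_2,r_2)+\sum_{j} j\, n_0^j(G_2,r_2)\big]$; (3) for $1\le i\le \delta$, $n_0^i(G,r_1) = n_0^i(G_1,r_1)\cdot\big[n_1(G_2,r_2)+\sum_j j\, n_0^j(G_2,r_2)\big] + n_0^{i-1}(G_1,r_1)\cdot n_0(G_2,r_2)$.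
   Context: An MEC (Markov equivalence class of DAGs) is represented by the union of its Markov equivalent DAGs, a graph with directed ($u\rightarrow v$) and undirected ($u-v$) edges; an MEC of an undirected graph $H$ is one whose skeleton (underlying undirected graph) is $H$. For a tree $H$ and node $r$ of degree $\delta_r$ in $H$: $n_1(H,r)$ is the number of MECs of $H$ having some edge directed into $r$ (some $x\rightarrow r$); $n_0(H,r)$ is the number of MECs of $H$ with no edge directed into $r$; and for $0\le i\le \delta_r$, $n_0^i(H,r)$ is the number of MECs of $H$ in which no edge at $r$ is directed into $r$, exactly $i$ edges at $r$ are undirected and the remaining $\delta_r-i$ are directed out of $r$ (so $n_0(H,r)=\sum_i n_0^i(H,r)$, and $n_0^i(H,r)=0$ for $i>\delta_r$). Sums over $j$ range over $0\le j\le \delta_2$. -}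

module Defs where

open import Level using (Level)
open import Data.Nat using (ℕ; zero; suc; _+_; _≤_)
open import Data.Fin using (Fin)
open import Data.List using (List; []; _∷_; _++_; length)
open import Data.List.Relation.Unary.Linked using (Linked)
open import Data.List.Relation.Unary.Unique.Propositional using (Unique)
open import Data.Product using (Σ; ∃; _×_; _,_)
open import Data.Sum using (_⊎_)
open import Relation.Nullary using (¬_; Dec)
open import Relation.Binary.PropositionalEquality using (_≡_; _≢_)
open import Relation.Binary.Construct.Closure.ReflexiveTransitive using (Star)
open import Relation.Binary.Construct.Closure.Transitive using (TransClosure)
open import Function.Bundles using (_⇔_)

record Graph (n : ℕ) : Set₁ where
  field
    V : Fin n → Set
    E : Fin n → Fin n → Set
open Graph public

IsSimple : ∀ {n} → Graph n → Set
IsSimple G =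
  (∀ u → Dec (V G u)) × (∀ u v → Dec (E G u v)) ×
  (∀ u v → E G u v → E G v u) ×
  (∀ u → ¬ E G u u) ×
  (∀ u v → E G u v → V G u × V G v)

Connected : ∀ {n} → Graph n → Set
Connected G = ∀ u v → V G u → V G v → Star (E G) u v

HasCycle : ∀ {n} → Graph n → Set
HasCycle {n} G = Σ (Fin n) λ x → Σ (List (Fin n)) λ ys →
  (2 ≤ length ys) × Unique (x ∷ ys) × Linked (E G) (x ∷ ys ++ x ∷ [])

IsTree : ∀ {n} → Graph n → Set
IsTree G = IsSimple G × (∃ λ v → V G v) × Connected G × ¬ HasCycle G

induced : ∀ {n} → Graph n → (Fin n → Set) → Graph n
induced G S = record
  { V = λ v → V G v × S v
  ; E = λ u v → E G u v × S u × S v }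

removeEdge : ∀ {n} → Graph n → Fin n → Fin n → Graph n
removeEdge G a b = record
  { V = V G
  ; E = λ u v → E G u v × ¬ (u ≡ a × v ≡ b) × ¬ (u ≡ b × v ≡ a) }

component : ∀ {n} → Graph n → Fin n → Fin n → Graph n
component G a b = induced G (λ v → Star (E (removeEdge G a b)) a v)

CountFin : ∀ {ℓ} {n} → (Fin n → Set ℓ) → ℕ → Set ℓ
CountFin {n = n} P k = Σ (Fin k → Fin n) λ f →
  (∀ i → P (f i)) × (∀ i j → f i ≡ f j → i ≡ j) ×
  (∀ v → P v → ∃ λ i → f i ≡ v)

Degree : ∀ {n} → Graph n → Fin n → ℕ → Set
Degree G r d = CountFin (λ v → E G r v) d

CountClasses : {A : Set₁} → (A → A → Set) → (A → Set₁) → ℕ → Set₁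
CountClasses {A} _~_ P k = Σ (Fin k → A) λ f →
  (∀ i → P (f i)) × (∀ i j → f i ~ f j → i ≡ j) ×
  (∀ D → P D → ∃ λ i → D ~ f i)

IsDAGOf : ∀ {n} → Graph n → (Fin n → Fin n → Set) → Set
IsDAGOf H D =
  (∀ u v → E H u v ⇔ (D u v ⊎ D v u)) ×
  (∀ u v → ¬ (D u v × D v u)) ×
  (∀ u → ¬ TransClosure D u u)

DAG : ∀ {n} → Graph n → Set₁
DAG {n} H = Σ (Fin n → Fin n → Set) (IsDAGOf H)

arr : ∀ {n} {H : Graph n} → DAG H → Fin n → Fin n → Set
arr (D , _) = D

VStruct : ∀ {n} (H : Graph n) → DAG H → Fin n → Fin n → Fin n → Set
VStruct H D a b c = arr {H = H} D a b × arr {H = H} D c b × a ≢ c × ¬ E H a c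

-- Markov equivalence of two DAGs with skeleton H (Verma–Pearl):
-- same skeleton (built in) and same v-structures
MarkovEq : ∀ {n} (H : Graph n) → DAG H → DAG H → Set
MarkovEq H D D' = ∀ a b c → VStruct H D a b c ⇔ VStruct H D' a b c

-- the MEC of D, represented as the union of its members:
-- u ⇒ v is an edge of the union
InUnion : ∀ {n} (H : Graph n) → DAG H → Fin n → Fin n → Set₁
InUnion H D u v = Σ (DAG H) λ D' → MarkovEq H D D' × arr {H = H} D' u v

Directed : ∀ {n} (H : Graph n) → DAG H → Fin n → Fin n → Set₁
Directed H D u v = InUnion H D u v × ¬ InUnion H D v u

Undirected : ∀ {n} (H : Graph n) → DAG H → Fin n → Fin n → Set₁
Undirected H D u v = InUnion H D u v × InUnion H D v u

IntoR : ∀ {n} (H : Graph n) → Fin n → DAG H → Set₁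
IntoR {n} H r D = Σ (Fin n) λ x → Directed H D x r

N1 : ∀ {n} → Graph n → Fin n → ℕ → Set₁
N1 H r k = CountClasses (MarkovEq H) (IntoR H r) k

N0 : ∀ {n} → Graph n → Fin n → ℕ → Set₁
N0 H r k = CountClasses (MarkovEq H) (λ D → ¬ IntoR H r D) k

ProfileAt : ∀ {n} (H : Graph n) → Fin n → ℕ → DAG H → Set₁
ProfileAt H r i D =
  ¬ IntoR H r D ×
  (∀ x → E H r x → Undirected H D r x ⊎ Directed H D r x) ×
  CountFin (λ x → Undirected H D r x) i

N0i : ∀ {n} → Graph n → Fin n → ℕ → ℕ → Set₁
N0i H r i k = CountClasses (MarkovEq H) (ProfileAt H r i) k

sumTo : ℕ → (ℕ → ℕ) → ℕ
sumTo zero f = f 0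
sumTo (suc m) f = sumTo m f + f (suc m)

-- A Markov equivalence class on G is determined by its restrictions to the subtrees G₁ and G₂,
-- the direction of the bridge r₁ – r₂ and the v-structures through the bridge. In a tree an arc
-- is compelled iff it lies in a v-structure or is forced from one along a directed path, and an
-- arc that is not compelled can be reversed within its class together with the chain of
-- ancestors above it. Consequently a class of G amounts to a class of G₁, a class of G₂, a
-- direction of the bridge and, when the bridge points into a root with no compelled parent on
-- its own side, the choice of that root's only parent among its undirected neighbours (or of
-- none). Counting these descriptions by the number of undirected edges at r₁ and at r₂ gives
-- the three formulas. All counting happens in the double-negation monad, which is harmless
-- because the conclusions are equations between natural numbers.

module Submission where

open import Level using (Level)
open import Data.Bool using (Bool; true; false)
open import Data.Empty using (⊥; ⊥-elim)
open import Data.Unit using (⊤; tt)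
open import Data.Nat using (ℕ; zero; suc; _+_; _*_; _∸_; _≤_; z≤n; s≤s)
open import Data.Nat.Properties using (≤-antisym; ≤-refl; m≤n⇒m≤1+n; ≤-pred; ≤∧≢⇒<; 1+n≰n)
  renaming (_≟_ to _≟ℕ_)
open import Data.Fin using (Fin; zero; suc)
open import Data.Fin.Properties using (injective⇒≤; suc-injective; _≟_; +↔⊎; *↔×)
open import Data.List using (List; []; _∷_; _++_)
open import Data.List.Membership.Propositional using (_∈_)
open import Data.List.Relation.Unary.Any using (here; there; any?)
open import Data.List.Relation.Unary.All using ([]; _∷_)
open import Data.List.Relation.Unary.All.Properties using (¬Any⇒All¬)
open import Data.List.Relation.Unary.AllPairs using ([]; _∷_)
open import Data.List.Relation.Unary.Linked as Linked using (Linked; []; [-]; _∷_)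
open import Data.List.Relation.Unary.Unique.Propositional using (Unique)
open import Data.Product using (Σ; ∃; _×_; _,_; proj₁; proj₂)
open import Data.Product.Function.NonDependent.Propositional using (_×-↔_)
open import Data.Sum as Sum using (_⊎_; inj₁; inj₂)
open import Data.Sum.Function.Propositional using (_⊎-↔_)
open import Function.Base using (id)
open import Function.Bundles using (_⇔_; mk⇔; Equivalence; _↔_; Inverse)
open import Function.Properties.Equivalence using ()
  renaming (refl to ⇔-refl; sym to ⇔-sym; trans to ⇔-trans)
open import Function.Properties.Inverse using (↔-refl; ↔-trans)
open import Relation.Nullary using (¬_; Dec; yes; no)
open import Relation.Nullary.Decidable using (decidable-stable; ¬¬-excluded-middle)
open import Relation.Binary.PropositionalEquality using (_≡_; _≢_; refl; sym; trans; cong; subst)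
open import Relation.Binary.Construct.Closure.ReflexiveTransitive as Star
  using (Star; ε; _◅_; _◅◅_)
open import Relation.Binary.Construct.Closure.Transitive using (TransClosure; [_]; _∷_)
open import Defs

open Equivalence using (to; from)

private variable ℓ ℓ' : Level

return : {A : Set ℓ} → A → ¬ ¬ A
return a k = k a

_>>=_ : {A : Set ℓ} {B : Set ℓ'} → ¬ ¬ A → (A → ¬ ¬ B) → ¬ ¬ B
(m >>= f) k = m (λ a → f a k)

¬¬-⊎¬ : (P : Set ℓ) → ¬ ¬ (P ⊎ ¬ P)
¬¬-⊎¬ P k = k (inj₂ (λ p → k (inj₁ p)))

¬¬-Π-Fin : ∀ n {P : Fin n → Set ℓ} → (∀ i → ¬ ¬ (P i)) → ¬ ¬ (∀ i → P i)
¬¬-Π-Fin zero h = return (λ ())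
¬¬-Π-Fin (suc n) {P} h = h zero >>= λ p0 → ¬¬-Π-Fin n (λ i → h (suc i)) >>= λ ps →
  return (λ { zero → p0 ; (suc i) → ps i })

¬¬-Π-↔ : ∀ {F} {X : Set} {Q : X → Set ℓ} → Fin F ↔ X → (∀ c → ¬ ¬ (Q c)) → ¬ ¬ (∀ c → Q c)
¬¬-Π-↔ {F = F} {Q = Q} e h = ¬¬-Π-Fin F (λ i → h (Inverse.to e i)) >>= λ g →
  return (λ c → subst Q (Inverse.strictlyInverseˡ e c) (g (Inverse.from e c)))

¬¬-→ : ∀ {P : Set ℓ} {Q : Set ℓ'} → (P → ¬ ¬ Q) → ¬ ¬ (P → Q)
¬¬-→ {P = P} h = ¬¬-⊎¬ P >>= λ
  { (inj₁ p) → h p >>= λ q → return (λ _ → q)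
  ; (inj₂ np) → return (λ p → ⊥-elim (np p)) }

SumUpTo : ℕ → (ℕ → Set) → Set
SumUpTo zero F = F 0
SumUpTo (suc m) F = SumUpTo m F ⊎ F (suc m)

Fin-sumTo↔SumUpTo : ∀ m (f : ℕ → ℕ) (F : ℕ → Set) → (∀ j → Fin (f j) ↔ F j) →
  Fin (sumTo m f) ↔ SumUpTo m F
Fin-sumTo↔SumUpTo zero f F e = e 0
Fin-sumTo↔SumUpTo (suc m) f F e = ↔-trans +↔⊎ (Fin-sumTo↔SumUpTo m f F e ⊎-↔ e (suc m))

module ClassCounting {A : Set₁} (_~_ : A → A → Set) (sym~ : ∀ {a b} → a ~ b → b ~ a)
  (trans~ : ∀ {a b c} → a ~ b → b ~ c → a ~ c) (P : A → Set₁) where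

  countClasses-unique : ∀ k → CountClasses _~_ P k → (X : Set) (F : ℕ) → Fin F ↔ X →
    (ρ : X → A) → (∀ c → P (ρ c)) → (∀ c c' → ρ c ~ ρ c' → c ≡ c') →
    (∀ D → P D → ¬ ¬ (Σ X λ c → D ~ ρ c)) → ¬ ¬ (k ≡ F)
  countClasses-unique k (g , Pg , ginj , gsurj) X F e ρ Pρ ρinj cov =
    ¬¬-Π-Fin k (λ i → cov (g i) (Pg i)) >>= λ q → return (≤-antisym (k≤F q) F≤k)
    where
    open Inverse e using () renaming (to to ι; from to ι⁻¹; strictlyInverseˡ to ι∘ι⁻¹; strictlyInverseʳ to ι⁻¹∘ι)
    classOf : Fin F → Fin k
    classOf c = proj₁ (gsurj (ρ (ι c)) (Pρ (ι c)))
    classOf-injective : ∀ {c c'} → classOf c ≡ classOf c' → c ≡ c'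
    classOf-injective {c} {c'} eq =
      trans (sym (ι⁻¹∘ι c)) (trans (cong ι⁻¹ (ρinj _ _ (trans~ p (sym~ p'')))) (ι⁻¹∘ι c'))
      where
      p : ρ (ι c) ~ g (classOf c)
      p = proj₂ (gsurj (ρ (ι c)) (Pρ (ι c)))
      p'' : ρ (ι c') ~ g (classOf c)
      p'' = subst (λ z → ρ (ι c') ~ g z) (sym eq) (proj₂ (gsurj (ρ (ι c')) (Pρ (ι c'))))
    F≤k : F ≤ k
    F≤k = injective⇒≤ classOf-injective
    k≤F : (∀ i → Σ X λ c → g i ~ ρ c) → k ≤ F
    k≤F q = injective⇒≤ {f = λ i → ι⁻¹ (proj₁ (q i))} inj
      where
      inj : ∀ {i j} → ι⁻¹ (proj₁ (q i)) ≡ ι⁻¹ (proj₁ (q j)) → i ≡ j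
      inj {i} {j} eq with q i | q j | cong ι eq
      ... | c , p | c' , p' | eq' with refl ← trans (sym (ι∘ι⁻¹ c)) (trans eq' (ι∘ι⁻¹ c')) =
        ginj i j (trans~ p (sym~ p'))

module _ {n : ℕ} where
  countFin-≤ : ∀ {P : Fin n → Set ℓ} {Q : Fin n → Set ℓ'} {k m} → CountFin P k → CountFin Q m →
    (∀ x → P x → Q x) → k ≤ m
  countFin-≤ {k = k} (f , Pf , finj , _) (g , Qg , ginj , gsurj) PQ = injective⇒≤ {f = h} hinj
    where
    h : Fin k → Fin _
    h i = proj₁ (gsurj (f i) (PQ _ (Pf i)))
    hinj : ∀ {i j} → h i ≡ h j → i ≡ j
    hinj {i} {j} e = finj i j (trans (sym (proj₂ (gsurj (f i) (PQ _ (Pf i)))))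
                       (trans (cong g e) (proj₂ (gsurj (f j) (PQ _ (Pf j))))))

  countFin-unique : ∀ {P : Fin n → Set ℓ} {Q : Fin n → Set ℓ'} {k m} → CountFin P k → CountFin Q m →
    (∀ x → P x → Q x) → (∀ x → Q x → P x) → k ≡ m
  countFin-unique c d pq qp = ≤-antisym (countFin-≤ c d pq) (countFin-≤ d c qp)

  countFin-cong : ∀ {P : Fin n → Set ℓ} {Q : Fin n → Set ℓ'} {k} → CountFin P k →
    (∀ x → P x → Q x) → (∀ x → Q x → P x) → CountFin Q k
  countFin-cong (f , Pf , finj , fsurj) pq qp = f , (λ i → pq _ (Pf i)) , finj , (λ v q → fsurj v (qp v q))

  countFin-insert : ∀ {P : Fin n → Set ℓ} {k a} → CountFin P k → ¬ P a → CountFin (λ x → P x ⊎ x ≡ a) (suc k)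
  countFin-insert {P = P} {k} {a} (f , Pf , finj , fsurj) npa = f' , Pf' , inj' , surj'
    where
    f' : Fin (suc k) → Fin n
    f' zero = a
    f' (suc i) = f i
    Pf' : ∀ i → P (f' i) ⊎ f' i ≡ a
    Pf' zero = inj₂ refl
    Pf' (suc i) = inj₁ (Pf i)
    inj' : ∀ i j → f' i ≡ f' j → i ≡ j
    inj' zero zero e = refl
    inj' zero (suc j) e = ⊥-elim (npa (subst P (sym e) (Pf j)))
    inj' (suc i) zero e = ⊥-elim (npa (subst P e (Pf i)))
    inj' (suc i) (suc j) e = cong suc (finj i j e)
    surj' : ∀ v → P v ⊎ v ≡ a → ∃ λ i → f' i ≡ v
    surj' v (inj₁ p) = suc (proj₁ (fsurj v p)) , proj₂ (fsurj v p)
    surj' v (inj₂ refl) = zero , refl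

countFin-dec : ∀ {m} (P : Fin m → Set ℓ) → (∀ x → Dec (P x)) → Σ ℕ (CountFin P)
countFin-dec {m = zero} P d = 0 , (λ ()) , (λ ()) , (λ ()) , (λ ())
countFin-dec {m = suc m} P d with countFin-dec (λ x → P (suc x)) (λ x → d (suc x))
... | k , f , Pf , finj , fsurj with d zero
... | yes p0 = suc k , f' , Pf' , inj' , surj'
  where
  f' : Fin (suc k) → Fin (suc m)
  f' zero = zero
  f' (suc i) = suc (f i)
  Pf' : ∀ i → P (f' i)
  Pf' zero = p0
  Pf' (suc i) = Pf i
  inj' : ∀ i j → f' i ≡ f' j → i ≡ j
  inj' zero zero e = refl
  inj' zero (suc j) ()
  inj' (suc i) zero ()
  inj' (suc i) (suc j) e = cong suc (finj i j (suc-injective e))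
  surj' : ∀ v → P v → ∃ λ i → f' i ≡ v
  surj' zero p = zero , refl
  surj' (suc v) p = suc (proj₁ (fsurj v p)) , cong suc (proj₂ (fsurj v p))
... | no np0 = k , (λ i → suc (f i)) , Pf , (λ i j e → finj i j (suc-injective e)) , surj'
  where
  surj' : ∀ v → P v → ∃ λ i → suc (f i) ≡ v
  surj' zero p = ⊥-elim (np0 p)
  surj' (suc v) p = proj₁ (fsurj v p) , cong suc (proj₂ (fsurj v p))

¬¬-countFin : ∀ {m} (P : Fin m → Set ℓ) → ¬ ¬ (Σ ℕ (CountFin P))
¬¬-countFin {m = m} P = ¬¬-Π-Fin m (λ x → ¬¬-excluded-middle) >>= λ d → return (countFin-dec P d)

module _ {Z : Set₁} (F : ℕ → Set) (Sp : ∀ j → F j → Z → Set₁) where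
  SpecUpTo : ∀ m → SumUpTo m F → Z → Set₁
  SpecUpTo zero x D = Sp 0 x D
  SpecUpTo (suc m) (inj₁ s) D = SpecUpTo m s D
  SpecUpTo (suc m) (inj₂ x) D = Sp (suc m) x D

  specUpTo-index : ∀ m s D → SpecUpTo m s D → Σ ℕ λ j → j ≤ m × Σ (F j) λ x → Sp j x D
  specUpTo-index zero x D h = 0 , z≤n , x , h
  specUpTo-index (suc m) (inj₁ s) D h with specUpTo-index m s D h
  ... | j , p , x , h' = j , m≤n⇒m≤1+n p , x , h'
  specUpTo-index (suc m) (inj₂ x) D h = suc m , ≤-refl , x , h

  specUpTo-intro : ∀ m j → j ≤ m → ∀ x D → Sp j x D → Σ (SumUpTo m F) λ s → SpecUpTo m s D
  specUpTo-intro zero .zero z≤n x D h = x , h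
  specUpTo-intro (suc m) j j≤ x D h with j ≟ℕ suc m
  ... | yes refl = inj₂ x , h
  ... | no j≢ with specUpTo-intro m j (≤-pred (≤∧≢⇒< j≤ j≢)) x D h
  ... | s , h' = inj₁ s , h'

  specUpTo-markov : ∀ {_~_ : Z → Z → Set} → (∀ j x D D' → Sp j x D → Sp j x D' → ¬ ¬ (D ~ D')) →
    ∀ m s D D' → SpecUpTo m s D → SpecUpTo m s D' → ¬ ¬ (D ~ D')
  specUpTo-markov h zero x D D' p q = h 0 x D D' p q
  specUpTo-markov h (suc m) (inj₁ s) D D' p q = specUpTo-markov h m s D D' p q
  specUpTo-markov h (suc m) (inj₂ x) D D' p q = h (suc m) x D D' p q

  specUpTo-injective : ∀ {_~_ : Z → Z → Set} →
    (∀ j j' x x' D D' → Sp j x D → Sp j' x' D' → D ~ D' → j ≡ j') →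
    (∀ j x x' D D' → Sp j x D → Sp j x' D' → D ~ D' → x ≡ x') →
    ∀ m s s' D D' → SpecUpTo m s D → SpecUpTo m s' D' → D ~ D' → s ≡ s'
  specUpTo-injective jeq xeq zero x x' D D' p q m = xeq 0 x x' D D' p q m
  specUpTo-injective jeq xeq (suc m) (inj₁ s) (inj₁ s') D D' p q e =
    cong inj₁ (specUpTo-injective jeq xeq m s s' D D' p q e)
  specUpTo-injective jeq xeq (suc m) (inj₂ x) (inj₂ x') D D' p q e = cong inj₂ (xeq (suc m) x x' D D' p q e)
  specUpTo-injective jeq xeq (suc m) (inj₁ s) (inj₂ x') D D' p q e with specUpTo-index m s D p
  ... | j , le , x , h with jeq j (suc m) x x' D D' h q e
  ... | refl = ⊥-elim (1+n≰n le)
  specUpTo-injective jeq xeq (suc m) (inj₂ x) (inj₁ s') D D' p q e with specUpTo-index m s' D' q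
  ... | j , le , x' , h with jeq (suc m) j x x' D D' p h e
  ... | refl = ⊥-elim (1+n≰n le)

  specUpTo-exists : ∀ {P : Z → Set₁} → (∀ j x → ¬ ¬ (Σ Z λ D → Sp j x D × P D)) →
    ∀ m s → ¬ ¬ (Σ Z λ D → SpecUpTo m s D × P D)
  specUpTo-exists h zero x = h 0 x
  specUpTo-exists h (suc m) (inj₁ s) = specUpTo-exists h m s
  specUpTo-exists h (suc m) (inj₂ x) = h (suc m) x

module _ {n : ℕ} where
  Rel : Set₁
  Rel = Fin n → Fin n → Set

  snoc : ∀ {R : Rel} {a b c} → Star R a b → R b c → Star R a c
  snoc rs r = rs ◅◅ (r ◅ ε)

  uncons⁺ : ∀ {R : Rel} {a b} → TransClosure R a b → Σ _ λ c → R a c × Star R c b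
  uncons⁺ [ r ] = _ , r , ε
  uncons⁺ (r ∷ rs) with uncons⁺ rs
  ... | c , r' , s = _ , r , (r' ◅ s)

  EndsAt : Fin n → List (Fin n) → Fin n → Set
  EndsAt a [] b = a ≡ b
  EndsAt a (x ∷ xs) b = EndsAt x xs b

  SimplePath : Rel → Fin n → Fin n → Set
  SimplePath R a b = Σ (List (Fin n)) λ xs → Linked R (a ∷ xs) × Unique (a ∷ xs) × EndsAt a xs b

  simplePath-suffix : ∀ {R : Rel} {a b} x xs → a ∈ (x ∷ xs) → Linked R (x ∷ xs) → Unique (x ∷ xs) →
    EndsAt x xs b → SimplePath R a b
  simplePath-suffix x xs (here refl) l u la = xs , l , u , la
  simplePath-suffix x (y ∷ ys) (there p) (_ ∷ l) (_ ∷ u) la = simplePath-suffix y ys p l u la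

  simplePath : ∀ {R : Rel} {a b} → Star R a b → SimplePath R a b
  simplePath ε = [] , [-] , [] ∷ [] , refl
  simplePath {a = a} (r ◅ rest) with simplePath rest
  ... | ys , l , u , la with any? (a ≟_) (_ ∷ ys)
  ... | yes p = simplePath-suffix _ ys p l u la
  ... | no ¬p = _ ∷ ys , r ∷ l , ¬Any⇒All¬ _ ¬p ∷ u , la

  linked-close : ∀ {R : Rel} x xs {b c} → Linked R (x ∷ xs) → EndsAt x xs b → R b c →
    Linked R (x ∷ xs ++ c ∷ [])
  linked-close x [] [-] refl r = r ∷ [-]
  linked-close x (y ∷ ys) (r' ∷ l) la r = r' ∷ linked-close y ys l la r

module TreeFacts {n : ℕ} (G : Graph n) (T : IsTree G) where
  edge-sym : ∀ {u v} → E G u v → E G v u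
  edge-sym = proj₁ (proj₂ (proj₂ (proj₁ T))) _ _

  edge-vertices : ∀ {u v} → E G u v → V G u × V G v
  edge-vertices = proj₂ (proj₂ (proj₂ (proj₂ (proj₁ T)))) _ _

  private
    loopE : ∀ u → ¬ E G u u
    loopE = proj₁ (proj₂ (proj₂ (proj₂ (proj₁ T))))
    conn : Connected G
    conn = proj₁ (proj₂ (proj₂ T))
    noCyc : ¬ HasCycle G
    noCyc = proj₂ (proj₂ (proj₂ T))

  adjacent⇒≢ : ∀ {a b} → E G a b → a ≢ b
  adjacent⇒≢ e refl = loopE _ e

  triangle-free : ∀ {a b c} → E G a b → E G b c → a ≢ c → ¬ E G a c
  triangle-free {a} {b} {c} ab bc a≢c ac =
    noCyc (a , b ∷ c ∷ [] , s≤s (s≤s z≤n) ,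
      ((adjacent⇒≢ ab ∷ a≢c ∷ []) ∷ (adjacent⇒≢ bc ∷ []) ∷ [] ∷ []) ,
      ab ∷ bc ∷ edge-sym ac ∷ [-])

  acyclic-orientation : (D : Fin n → Fin n → Set) → (∀ {u v} → D u v → E G u v) →
    (∀ {u v} → D u v → D v u → ⊥) → ∀ u → ¬ TransClosure D u u
  acyclic-orientation D sub asym u tc with uncons⁺ tc
  ... | x , d , s with simplePath s
  ... | [] , l , un , refl = loopE _ (sub d)
  ... | y ∷ [] , l , un , refl = asym d (headL l)
    where headL : ∀ {a b xs} → Linked D (a ∷ b ∷ xs) → D a b
          headL (r ∷ _) = r
  ... | y ∷ z ∷ zs , l , un , la =
    noCyc (x , y ∷ z ∷ zs , s≤s (s≤s z≤n) , un ,
           Linked.map sub (linked-close x (y ∷ z ∷ zs) l la d))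

  Cut : Fin n → Fin n → Fin n → Fin n → Set
  Cut a b = E (removeEdge G a b)

  Side : Fin n → Fin n → Fin n → Set
  Side a b x = Star (Cut a b) a x

  ≟-pair : (x y a b : Fin n) → Dec (x ≡ a × y ≡ b)
  ≟-pair x y a b with x ≟ a | y ≟ b
  ... | yes p | yes q = yes (p , q)
  ... | no p | _ = no (λ z → p (proj₁ z))
  ... | yes _ | no q = no (λ z → q (proj₂ z))

  side-step : ∀ {a b x y} → E G x y → Side a b x → Side a b y ⊎ (x ≡ a × y ≡ b)
  side-step {a} {b} {x} {y} e s with ≟-pair x y a b | ≟-pair x y b a
  ... | yes p | _ = inj₂ p
  ... | no _ | yes (refl , refl) = inj₁ ε
  ... | no p | no q = inj₁ (snoc s (e , p , q))

  side-walk : ∀ {a b x y} → Star (E G) x y → Side a b x ⊎ Side b a x → Side a b y ⊎ Side b a y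
  side-walk ε s = s
  side-walk {a} {b} (e ◅ es) (inj₁ s) with side-step e s
  ... | inj₁ s' = side-walk es (inj₁ s')
  ... | inj₂ (refl , refl) = side-walk es (inj₂ ε)
  side-walk {a} {b} (e ◅ es) (inj₂ s) with side-step e s
  ... | inj₁ s' = side-walk es (inj₂ s')
  ... | inj₂ (refl , refl) = side-walk es (inj₁ ε)

  side-cover : ∀ {a b x} → E G a b → V G x → Side a b x ⊎ Side b a x
  side-cover {a} {b} {x} e vx = side-walk (conn a x (proj₁ (edge-vertices e)) vx) (inj₁ ε)

  cut-sym : ∀ {a b x y} → Cut a b x y → Cut a b y x
  cut-sym (e , p , q) = edge-sym e , (λ { (refl , refl) → q (refl , refl) }) , (λ { (refl , refl) → p (refl , refl) })

  cut-swap : ∀ {a b x y} → Cut a b x y → Cut b a x y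
  cut-swap (e , p , q) = e , q , p

  sides-disjoint : ∀ {a b x} → E G a b → Side a b x → Side b a x → ⊥
  sides-disjoint {a} {b} eab sa sb with simplePath (sa ◅◅ Star.reverse cut-sym (Star.map cut-swap sb))
  ... | [] , l , un , refl = loopE _ eab
  ... | y ∷ [] , (r ∷ _) , un , refl = proj₁ (proj₂ r) (refl , refl)
  ... | y ∷ z ∷ zs , l , un , la =
    noCyc (a , y ∷ z ∷ zs , s≤s (s≤s z≤n) , un ,
           linked-close a (y ∷ z ∷ zs) (Linked.map proj₁ l) la (edge-sym eab))

-- Arcs forced in every Markov equivalent DAG of a triangle-free skeleton: members of a v-structure
-- and their continuations w → u → v (Meek's first rule; w and v are never adjacent).
module _ {n : ℕ} where
  data Compelled (D : Fin n → Fin n → Set) : Fin n → Fin n → Set where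
    v-struct : ∀ {u v y} → D u v → D y v → y ≢ u → Compelled D u v
    propagated : ∀ {u v w} → D u v → Compelled D w u → Compelled D u v

  compelled⇒arc : ∀ {D u v} → Compelled D u v → D u v
  compelled⇒arc (v-struct d _ _) = d
  compelled⇒arc (propagated d _) = d

  Compelled-map : ∀ {D D' : Fin n → Fin n → Set} → (∀ {x y} → D x y → D' x y) → ∀ {u v} → Compelled D u v → Compelled D' u v
  Compelled-map f (v-struct a b c) = v-struct (f a) (f b) c
  Compelled-map f (propagated a c) = propagated (f a) (Compelled-map f c)

data ParentRule (n : ℕ) : Set where
  anyParents noParents : ParentRule n
  onlyParent : Fin n → ParentRule n

module Orientations {n : ℕ} (H : Graph n)
  (symE : ∀ {u v} → E H u v → E H v u)
  (triangle-free : ∀ {a b c} → E H a b → E H b c → a ≢ c → ¬ E H a c)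
  (acyc : (D : Fin n → Fin n → Set) → (∀ {u v} → D u v → E H u v) →
          (∀ {u v} → D u v → D v u → ⊥) → ∀ u → ¬ TransClosure D u u) where

  Arc : DAG H → Fin n → Fin n → Set
  Arc D = arr {H = H} D

  arc⇒edge : ∀ (D : DAG H) {u v} → Arc D u v → E H u v
  arc⇒edge D d = from (proj₁ (proj₂ D) _ _) (inj₁ d)

  orient : ∀ (D : DAG H) {u v} → E H u v → Arc D u v ⊎ Arc D v u
  orient D e = to (proj₁ (proj₂ D) _ _) e

  arc-asym : ∀ (D : DAG H) {u v} → Arc D u v → Arc D v u → ⊥
  arc-asym D a b = proj₁ (proj₂ (proj₂ D)) _ _ (a , b)

  markov-refl : ∀ (D : DAG H) → MarkovEq H D D
  markov-refl D a b c = ⇔-refl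
  markov-sym : ∀ (D D' : DAG H) → MarkovEq H D D' → MarkovEq H D' D
  markov-sym D D' m a b c = ⇔-sym (m a b c)
  markov-trans : ∀ (D D' D'' : DAG H) → MarkovEq H D D' → MarkovEq H D' D'' → MarkovEq H D D''
  markov-trans D D' D'' m m' a b c = ⇔-trans (m a b c) (m' a b c)

  inUnion-markov : ∀ (D D' : DAG H) {u v} → MarkovEq H D D' → InUnion H D u v → InUnion H D' u v
  inUnion-markov D D' m (D'' , m' , d) = D'' , markov-trans D' D D'' (markov-sym D D' m) m' , d

  directed-markov : ∀ (D D' : DAG H) {u v} → MarkovEq H D D' → Directed H D u v → Directed H D' u v
  directed-markov D D' m (i , ni) = inUnion-markov D D' m i , λ j → ni (inUnion-markov D' D (markov-sym D D' m) j)

  undirected-markov : ∀ (D D' : DAG H) {u v} → MarkovEq H D D' → Undirected H D u v → Undirected H D' u v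
  undirected-markov D D' m (i , j) = inUnion-markov D D' m i , inUnion-markov D D' m j

  intoR-markov : ∀ (D D' : DAG H) {r} → MarkovEq H D D' → IntoR H r D → IntoR H r D'
  intoR-markov D D' m (x , d) = x , directed-markov D D' m d

  compelled-sound : ∀ (D D' : DAG H) {u v} → Compelled (Arc D) u v → MarkovEq H D D' → Arc D' u v
  compelled-sound D D' (v-struct {u} {v} {y} uv yv y≢u) m =
    proj₁ (to (m u v y) (uv , yv , (λ e → y≢u (sym e)) ,
       triangle-free (arc⇒edge D uv) (symE (arc⇒edge D yv)) (λ e → y≢u (sym e))))
  compelled-sound D D' (propagated {u} {v} {w} uv c) m with compelled-sound D D' c m | orient D' (arc⇒edge D uv)
  ... | wu' | inj₁ uv' = uv'
  ... | wu' | inj₂ vu' = ⊥-elim (arc-asym D uv (proj₁ (proj₂ (from (m w u v)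
          (wu' , vu' , w≢v , triangle-free (arc⇒edge D' wu') (symE (arc⇒edge D' vu')) w≢v)))))
    where w≢v : w ≢ v
          w≢v refl = arc-asym D uv (compelled⇒arc c)

  compelled⇒directed : ∀ (D : DAG H) {u v} → Compelled (Arc D) u v → Directed H D u v
  compelled⇒directed D c = (D , markov-refl D , compelled⇒arc c) , λ
      { (D' , m , vu) → arc-asym D' (compelled-sound D D' c m) vu }

  directed⇒arc : ∀ (D : DAG H) {u v} → Directed H D u v → Arc D u v
  directed⇒arc D ((D' , m , uv) , ni) with orient D (arc⇒edge D' uv)
  ... | inj₁ x = x
  ... | inj₂ y = ⊥-elim (ni (D , markov-refl D , y))

  star⇒tc : ∀ {R : Fin n → Fin n → Set} {x y z} → R x y → Star R y z → TransClosure R x z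
  star⇒tc r ε = [ r ]
  star⇒tc r (r' ◅ rs) = r ∷ star⇒tc r' rs

  no-cycle : ∀ (D : DAG H) {a b} → Star (Arc D) a b → Arc D b a → ⊥
  no-cycle D s ba = proj₂ (proj₂ (proj₂ D)) _ (star⇒tc ba s)

  unsnoc : ∀ {R : Fin n → Fin n → Set} {a b} → Star R a b → a ≡ b ⊎ Σ _ λ z → Star R a z × R z b
  unsnoc ε = inj₁ refl
  unsnoc (r ◅ rs) with unsnoc rs
  ... | inj₁ refl = inj₂ (_ , ε , r)
  ... | inj₂ (z , s , r') = inj₂ (z , r ◅ s , r')

  -- If u ⟶ v is not compelled, no vertex at or above u has two parents, so the ancestors of u form
  -- a single directed path; flipping it together with u ⟶ v creates and destroys no v-structure.
  module ChainReversal (D : DAG H) (u v : Fin n) (duv : Arc D u v) (nc : ¬ Compelled (Arc D) u v)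
            (ancestor? : ∀ x → Dec (Star (Arc D) x u)) where
    _⟶_ : Fin n → Fin n → Set
    _⟶_ = Arc D
    Ancestor : Fin n → Set
    Ancestor x = Star _⟶_ x u
    Flipped : Fin n → Fin n → Set
    Flipped x y = x ⟶ y × (Ancestor y ⊎ (x ≡ u × y ≡ v))
    Rev : Fin n → Fin n → Set
    Rev x y = (x ⟶ y × ¬ Flipped x y) ⊎ Flipped y x

    flipped? : ∀ {x y} → x ⟶ y → Dec (Flipped x y)
    flipped? {x} {y} xy with ancestor? y | x ≟ u | y ≟ v
    ... | yes a | _ | _ = yes (xy , inj₁ a)
    ... | no _ | yes p | yes q = yes (xy , inj₂ (p , q))
    ... | no na | no p | _ = no λ { (_ , inj₁ a) → na a ; (_ , inj₂ (p' , _)) → p p' }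
    ... | no na | yes _ | no q = no λ { (_ , inj₁ a) → na a ; (_ , inj₂ (_ , q')) → q q' }

    compelled-propagates : ∀ {a b} → Compelled _⟶_ a b → Ancestor b → Compelled _⟶_ u v
    compelled-propagates c ε = propagated duv c
    compelled-propagates c (d ◅ ds) = compelled-propagates (propagated d c) ds

    v-parent≡u : ∀ {y} → y ⟶ v → y ≡ u
    v-parent≡u {y} yv with y ≟ u
    ... | yes p = p
    ... | no p = ⊥-elim (nc (v-struct duv yv (λ e → p e)))

    ancestor-parent-unique : ∀ {x p q} → Ancestor x → p ⟶ x → q ⟶ x → p ≡ q
    ancestor-parent-unique {x} {p} {q} ax px qx with p ≟ q
    ... | yes e = e
    ... | no ne = ⊥-elim (nc (compelled-propagates (v-struct px qx (λ e → ne (sym e))) ax))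

    ancestors-linear : ∀ {x y} → Ancestor x → Ancestor y → Star _⟶_ x y ⊎ Star _⟶_ y x
    ancestors-linear ε ay = inj₂ ay
    ancestors-linear (d ◅ ds) ay with ancestors-linear ds ay
    ... | inj₁ s = inj₁ (d ◅ s)
    ... | inj₂ s with unsnoc s
    ... | inj₁ refl = inj₁ (d ◅ ε)
    ... | inj₂ (z , s' , zx1) with ancestor-parent-unique ds zx1 d
    ... | refl = inj₂ s'

    rev-into-ancestor : ∀ {a b} → Ancestor b → Rev a b → b ⟶ a × (Ancestor a ⊎ (b ≡ u × a ≡ v))
    rev-into-ancestor ab (inj₁ (x , nr)) = ⊥-elim (nr (x , inj₁ ab))
    rev-into-ancestor ab (inj₂ r) = r

    siblings-on-path : ∀ {a b c} → Star _⟶_ a c → b ⟶ a → b ⟶ c → Ancestor c → a ≡ c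
    siblings-on-path s ba bc ac with unsnoc s
    ... | inj₁ e = e
    ... | inj₂ (z , s' , zc) with ancestor-parent-unique ac zc bc
    ... | refl = ⊥-elim (no-cycle D s' ba)

    rev-parent-unique : ∀ {a b c} → Ancestor b → Rev a b → Rev c b → a ≡ c
    rev-parent-unique {a} {b} {c} ab p q with rev-into-ancestor ab p | rev-into-ancestor ab q
    ... | ba , inj₂ (_ , refl) | bc , inj₂ (_ , refl) = refl
    ... | ba , inj₁ aa | bc , inj₂ (refl , _) = ⊥-elim (no-cycle D aa ba)
    ... | ba , inj₂ (refl , _) | bc , inj₁ ac = ⊥-elim (no-cycle D ac bc)
    ... | ba , inj₁ aa | bc , inj₁ ac with ancestors-linear aa ac
    ... | inj₁ s = siblings-on-path s ba bc ac
    ... | inj₂ s = sym (siblings-on-path s bc ba aa)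

    rev-v-parentless : ∀ {a} → Rev a v → ⊥
    rev-v-parentless (inj₁ (av , nr)) with v-parent≡u av
    ... | refl = nr (duv , inj₂ (refl , refl))
    rev-v-parentless (inj₂ (va , inj₁ aa)) = no-cycle D (aa ◅◅ (duv ◅ ε)) va
    rev-v-parentless (inj₂ (va , inj₂ (refl , _))) = arc-asym D duv duv

    rev-u-parent : ∀ {a} → Rev a u → a ≡ v
    rev-u-parent (inj₁ (au , nr)) = ⊥-elim (nr (au , inj₁ ε))
    rev-u-parent (inj₂ (ua , inj₁ aa)) = ⊥-elim (no-cycle D aa ua)
    rev-u-parent (inj₂ (ua , inj₂ (_ , e))) = e

    rev-elsewhere : ∀ {a b} → ¬ Ancestor b → b ≢ v → Rev a b ⇔ (a ⟶ b)
    rev-elsewhere {a} {b} nb nv = mk⇔ f (λ ab → inj₁ (ab , λ { (_ , inj₁ x) → nb x ; (_ , inj₂ (_ , e)) → nv e }))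
      where
      f : Rev a b → a ⟶ b
      f (inj₁ (x , _)) = x
      f (inj₂ (ba , inj₁ aa)) = ⊥-elim (nb (ba ◅ aa))
      f (inj₂ (ba , inj₂ (refl , _))) = ⊥-elim (nb ε)

    rev-skeleton : ∀ x y → E H x y ⇔ (Rev x y ⊎ Rev y x)
    rev-skeleton x y = mk⇔ to' from'
      where
      to' : E H x y → Rev x y ⊎ Rev y x
      to' e with orient D e
      ... | inj₁ xy with flipped? xy
      ... | yes r = inj₂ (inj₂ r)
      ... | no nr = inj₁ (inj₁ (xy , nr))
      to' e | inj₂ yx with flipped? yx
      ... | yes r = inj₁ (inj₂ r)
      ... | no nr = inj₂ (inj₁ (yx , nr))
      from' : Rev x y ⊎ Rev y x → E H x y
      from' (inj₁ (inj₁ (xy , _))) = arc⇒edge D xy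
      from' (inj₁ (inj₂ (yx , _))) = symE (arc⇒edge D yx)
      from' (inj₂ (inj₁ (yx , _))) = symE (arc⇒edge D yx)
      from' (inj₂ (inj₂ (xy , _))) = arc⇒edge D xy

    rev-asym : ∀ {x y} → Rev x y → Rev y x → ⊥
    rev-asym (inj₁ (xy , _)) (inj₁ (yx , _)) = arc-asym D xy yx
    rev-asym (inj₁ (_ , nr)) (inj₂ r) = nr r
    rev-asym (inj₂ r) (inj₁ (_ , nr)) = nr r
    rev-asym (inj₂ (yx , _)) (inj₂ (xy , _)) = arc-asym D xy yx

    rev⇒edge : ∀ {x y} → Rev x y → E H x y
    rev⇒edge d = from (rev-skeleton _ _) (inj₁ d)

    reversed : DAG H
    reversed = Rev , rev-skeleton , (λ x y p → rev-asym (proj₁ p) (proj₂ p)) , acyc Rev rev⇒edge rev-asym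

    reversed-markov : MarkovEq H D reversed
    reversed-markov a b c with ancestor? b | b ≟ v
    ... | yes ab | _ = mk⇔ (λ { (p , q , ne , _) → ⊥-elim (ne (ancestor-parent-unique ab p q)) })
                           (λ { (p , q , ne , _) → ⊥-elim (ne (rev-parent-unique ab p q)) })
    ... | no _ | yes refl = mk⇔ (λ { (p , q , ne , _) → ⊥-elim (ne (trans (v-parent≡u p) (sym (v-parent≡u q)))) })
                               (λ { (p , q , ne , _) → ⊥-elim (rev-v-parentless p) })
    ... | no nb | no nv = mk⇔ (λ { (p , q , ne , ne') → from (rev-elsewhere nb nv) p , from (rev-elsewhere nb nv) q , ne ,
          ne' })
                              (λ { (p , q , ne , ne') → to (rev-elsewhere nb nv) p , to (rev-elsewhere nb nv) q , ne , ne' })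

    reversal : Σ (DAG H) λ D'' → MarkovEq H D D'' × Arc D'' v u × (∀ a → ¬ Arc D'' a v) × (∀ a → Arc D'' a u → a ≡ v)
    reversal = reversed , reversed-markov , inj₂ (duv , inj₂ (refl , refl)) , (λ a → rev-v-parentless) , (λ a → rev-u-parent)

  reverse-uncompelled : ∀ (D : DAG H) {u v} → Arc D u v → ¬ Compelled (Arc D) u v →
    ¬ ¬ (Σ (DAG H) λ D'' → MarkovEq H D D'' × Arc D'' v u × (∀ a → ¬ Arc D'' a v) × (∀ a → Arc D'' a u → a ≡ v))
  reverse-uncompelled D {u} {v} duv nc =
    ¬¬-Π-Fin n (λ x → ¬¬-excluded-middle) >>= λ dec →
    return (ChainReversal.reversal D u v duv nc dec)

  directed⇒compelled : ∀ (D : DAG H) {u v} → Directed H D u v → ¬ ¬ (Compelled (Arc D) u v)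
  directed⇒compelled D {u} {v} d = ¬¬-⊎¬ (Compelled (Arc D) u v) >>= λ
    { (inj₁ c) → return c
    ; (inj₂ nc) → reverse-uncompelled D (directed⇒arc D d) nc >>= λ { (D' , m , vu , _) → ⊥-elim (proj₂ d (D' , m , vu)) } }

  undirected⇒¬compelled : ∀ (D : DAG H) {u v} → Undirected H D u v → ¬ Compelled (Arc D) u v
  undirected⇒¬compelled D (_ , (D' , m , vu)) c = arc-asym D' (compelled-sound D D' c m) vu

  ¬compelled⇒undirected : ∀ (D : DAG H) {u v} → E H u v → ¬ Compelled (Arc D) u v → ¬ Compelled (Arc D) v u →
    ¬ ¬ (Undirected H D u v)
  ¬compelled⇒undirected D e nc nc' with orient D e
  ... | inj₁ uv = reverse-uncompelled D uv nc >>= λ { (D' , m , vu , _) → return ((D , markov-refl D , uv) , (D' , m , vu)) }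
  ... | inj₂ vu = reverse-uncompelled D vu nc' >>= λ
      { (D' , m , uv , _) → return ((D' , m , uv) , (D , markov-refl D , vu)) }

  two-parents⇒intoR : ∀ (D : DAG H) {r x y} → Arc D x r → Arc D y r → x ≢ y → IntoR H r D
  two-parents⇒intoR D xr yr ne = _ , compelled⇒directed D (v-struct xr yr (λ e → ne (sym e)))

  ¬intoR⇒¬compelled : ∀ (D : DAG H) {r x} → ¬ IntoR H r D → ¬ Compelled (Arc D) x r
  ¬intoR⇒¬compelled D ni c = ni (_ , compelled⇒directed D c)

  ¬intoR⇒parent-unique : ∀ (D : DAG H) {r a x} → ¬ IntoR H r D → Arc D a r → Arc D x r → a ≡ x
  ¬intoR⇒parent-unique D {a = a} {x} ni ar xr with a ≟ x
  ... | yes p = p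
  ... | no ne = ⊥-elim (ni (two-parents⇒intoR D ar xr ne))

  parentless-member : ∀ (D : DAG H) {r} → ¬ IntoR H r D → ¬ ¬ (Σ (DAG H) λ D' → MarkovEq H D D' × (∀ a → ¬ Arc D' a r))
  parentless-member D {r} ni = ¬¬-⊎¬ (Σ _ λ x → Arc D x r) >>= λ
    { (inj₂ no') → return (D , markov-refl D , λ a d → no' (a , d))
    ; (inj₁ (x , xr)) → reverse-uncompelled D xr (¬intoR⇒¬compelled D ni) >>= λ
        { (D' , m , _ , np , _) → return (D' , m , np) } }

  single-parent-member : ∀ (D : DAG H) {r y} → (∀ a → ¬ Arc D a r) → Undirected H D r y →
    ¬ ¬ (Σ (DAG H) λ D' → MarkovEq H D D' × Arc D' y r × (∀ a → Arc D' a r → a ≡ y))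
  single-parent-member D {r} {y} np und@((D0 , _ , ry0) , _) with orient D (arc⇒edge D0 ry0)
  ... | inj₂ yr = ⊥-elim (np y yr)
  ... | inj₁ ry = reverse-uncompelled D ry (undirected⇒¬compelled D und) >>= λ
      { (D' , m , yr' , _ , pu) → return (D' , m , yr' , pu) }

  Obeys : DAG H → Fin n → ParentRule n → Set
  Obeys D r anyParents = ⊤
  Obeys D r noParents = ∀ a → ¬ Arc D a r
  Obeys D r (onlyParent y) = Arc D y r × (∀ a → Arc D a r → a ≡ y)

  parent-markov : ∀ (D D' : DAG H) {r} → IntoR H r D → MarkovEq H D D' → ∀ y → Arc D y r → ¬ ¬ (Arc D' y r)
  parent-markov D D' {r} (x , dx) m y yr = directed⇒compelled D dx >>= λ c → return (f c)
    where
    f : Compelled (Arc D) x r → Arc D' y r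
    f c with y ≟ x
    ... | yes refl = compelled-sound D D' c m
    ... | no ne = compelled-sound D D' (v-struct yr (compelled⇒arc c) (λ e → ne (sym e))) m

  parents-agree : ∀ (D D' : DAG H) {r} (p : ParentRule n) → MarkovEq H D D' → Obeys D r p → Obeys D' r p →
    (p ≡ anyParents → IntoR H r D) → ∀ x → ¬ ¬ (Arc D x r ⇔ Arc D' x r)
  parents-agree D D' {r} anyParents m _ _ ii x =
    ¬¬-⊎¬ (Arc D x r) >>= λ { (inj₁ d) → parent-markov D D' (ii refl) m x d >>= λ d' → return (mk⇔ (λ _ → d') (λ _ → d))
                          ; (inj₂ nd) → ¬¬-⊎¬ (Arc D' x r) >>= λ
                              { (inj₁ d') → parent-markov D' D (intoR-markov D D' m (ii refl)) (markov-sym D D' m) x d' >>=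
                                    λ d → ⊥-elim (nd d)
                              ; (inj₂ nd') → return (mk⇔ (λ d → ⊥-elim (nd d)) (λ d → ⊥-elim (nd' d))) } }
  parents-agree D D' noParents m p q _ x = return (mk⇔ (λ d → ⊥-elim (p x d)) (λ d → ⊥-elim (q x d)))
  parents-agree D D' (onlyParent y) m (dy , p) (dy' , q) _ x =
    return (mk⇔ (λ d → subst (λ z → Arc D' z _) (sym (p x d)) dy') (λ d → subst (λ z → Arc D z _) (sym (q x d)) dy))

  edge-classified : ∀ (D : DAG H) {r} → ¬ IntoR H r D → ∀ x → ¬ ¬ (E H r x → Undirected H D r x ⊎ Directed H D r x)
  edge-classified D {r} ni x = ¬¬-⊎¬ (Compelled (Arc D) r x) >>= λ
    { (inj₁ c) → return (λ _ → inj₂ (compelled⇒directed D c))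
    ; (inj₂ nc) → ¬¬-⊎¬ (E H r x) >>= λ
        { (inj₁ e) → ¬compelled⇒undirected D e nc (¬intoR⇒¬compelled D ni) >>= λ u → return (λ _ → inj₁ u)
        ; (inj₂ ne) → return (λ e → ⊥-elim (ne e)) } }

  profile-exists : ∀ (D : DAG H) {r} → ¬ IntoR H r D → ¬ ¬ (Σ ℕ λ i → ProfileAt H r i D)
  profile-exists D {r} ni = ¬¬-Π-Fin n (edge-classified D ni) >>= λ ed →
    ¬¬-countFin (λ x → Undirected H D r x) >>= λ { (i , c) → return (i , ni , ed , c) }

  parent⇒undirected : ∀ (D : DAG H) {r x} → ¬ IntoR H r D → Arc D x r → ¬ ¬ (Undirected H D r x)
  parent⇒undirected D ni xr = reverse-uncompelled D xr (¬intoR⇒¬compelled D ni) >>= λ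
      { (D' , m , rx , _) → return ((D' , m , rx) , (D , markov-refl D , xr)) }

  profile-markov : ∀ (D D' : DAG H) {r i} → MarkovEq H D D' → ProfileAt H r i D → ProfileAt H r i D'
  profile-markov D D' m (ni , ed , cf) =
    (λ ii → ni (intoR-markov D' D (markov-sym D D' m) ii)) ,
    (λ x e → Sum.map (undirected-markov D D' m) (directed-markov D D' m) (ed x e)) ,
    countFin-cong cf (λ x → undirected-markov D D' m) (λ x → undirected-markov D' D (markov-sym D D' m))

  obeys-transport : ∀ (P Q : DAG H) {r} (p : ParentRule n) → (∀ u v → Arc P u v ⇔ Arc Q u v) → Obeys P r p → Obeys Q r p
  obeys-transport P Q anyParents e _ = tt
  obeys-transport P Q noParents e h a d = h a (from (e a _) d)
  obeys-transport P Q (onlyParent y) e (d , h) = to (e y _) d , (λ a d' → h a (from (e a _) d'))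

TransClosure-map : ∀ {n} {R S : Fin n → Fin n → Set} → (∀ {x y} → R x y → S x y) → ∀ {a b} → TransClosure R a b →
  TransClosure S a b
TransClosure-map f [ r ] = [ f r ]
TransClosure-map f (r ∷ rs) = f r ∷ TransClosure-map f rs

same-arcs⇒markov : ∀ {n} (H : Graph n) (D D' : DAG H) → (∀ u v → arr {H = H} D u v ⇔ arr {H = H} D' u v) → MarkovEq H D D'
same-arcs⇒markov H D D' p a b c = mk⇔ (λ { (x , y , z , w) → to (p a b) x , to (p c b) y , z , w })
                          (λ { (x , y , z , w) → from (p a b) x , from (p c b) y , z , w })

vstruct-swap : ∀ {n} (H : Graph n) (symE : ∀ {u v} → E H u v → E H v u) (D : DAG H) {a b c} → VStruct H D a b c →
  VStruct H D c b a
vstruct-swap H symE D (p , q , ne , nE) = q , p , (λ e → ne (sym e)) , (λ e → nE (symE e))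

module TreeDAGs {n : ℕ} (G : Graph n) (T : IsTree G) where
  open TreeFacts G T public
  module OnG = Orientations G edge-sym triangle-free acyclic-orientation

module SideOf {n : ℕ} (G : Graph n) (T : IsTree G) (a b : Fin n) (eab : E G a b) where
  open TreeDAGs G T
  OnSide : Fin n → Set
  OnSide = Side a b
  Gₐ : Graph n
  Gₐ = component G a b

  edgeₐ-sym : ∀ {u v} → E Gₐ u v → E Gₐ v u
  edgeₐ-sym (e , s , t) = edge-sym e , t , s
  triangle-freeₐ : ∀ {x y z} → E Gₐ x y → E Gₐ y z → x ≢ z → ¬ E Gₐ x z
  triangle-freeₐ e f ne g = triangle-free (proj₁ e) (proj₁ f) ne (proj₁ g)
  acyclicₐ : (D : Fin n → Fin n → Set) → (∀ {u v} → D u v → E Gₐ u v) →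
          (∀ {u v} → D u v → D v u → ⊥) → ∀ u → ¬ TransClosure D u u
  acyclicₐ D sub = acyclic-orientation D (λ d → proj₁ (sub d))
  module OnGₐ = Orientations Gₐ edgeₐ-sym triangle-freeₐ acyclicₐ

  a-onSide : OnSide a
  a-onSide = ε
  b-offSide : ¬ OnSide b
  b-offSide s = sides-disjoint eab s ε

  restrict : DAG G → DAG Gₐ
  restrict D = R , skel , (λ u v p → OnG.arc-asym D (proj₁ (proj₁ p)) (proj₁ (proj₂ p))) ,
          (λ u tc → proj₂ (proj₂ (proj₂ D)) u (TransClosure-map proj₁ tc))
    where
    R : Fin n → Fin n → Set
    R u v = OnG.Arc D u v × OnSide u × OnSide v
    skel : ∀ u v → E Gₐ u v ⇔ (R u v ⊎ R v u)
    skel u v = mk⇔ (λ { (e , su , sv) → Sum.map (λ d → d , su , sv) (λ d → d , sv , su) (OnG.orient D e) })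
                   (λ { (inj₁ (d , su , sv)) → OnG.arc⇒edge D d , su , sv ; (inj₂ (d , sv , su)) → edge-sym
                         (OnG.arc⇒edge D d) , su , sv })

  Arcₐ : DAG Gₐ → Fin n → Fin n → Set
  Arcₐ D = arr {H = Gₐ} D

  compelled-restrict : ∀ (D : DAG G) {u v} → Compelled (OnG.Arc D) u v → OnSide u → OnSide v →
    Compelled (Arcₐ (restrict D)) u v ⊎ Compelled (OnG.Arc D) b a
  compelled-restrict D (v-struct {u} {v} {y} uv yv y≢u) su sv with side-step (edge-sym (OnG.arc⇒edge D yv)) sv
  ... | inj₁ sy = inj₁ (v-struct (uv , su , sv) (yv , sy , sv) y≢u)
  ... | inj₂ (refl , refl) = inj₂ (v-struct yv uv (λ e → y≢u (sym e)))
  compelled-restrict D (propagated {u} {v} {w} uv c) su sv with side-step (edge-sym (OnG.arc⇒edge D (compelled⇒arc c))) su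
  ... | inj₁ sw with compelled-restrict D c sw su
  ... | inj₁ c' = inj₁ (propagated (uv , su , sv) c')
  ... | inj₂ c' = inj₂ c'
  compelled-restrict D (propagated {u} {v} {w} uv c) su sv | inj₂ (refl , refl) = inj₂ c

  neighbour-inSide : ∀ {x} → E G a x → x ≢ b → OnSide x
  neighbour-inSide {x} e ne with side-step e a-onSide
  ... | inj₁ s = s
  ... | inj₂ (_ , e') = ⊥-elim (ne e')

  vstruct-restrict : ∀ (D : DAG G) {x y z} → OnSide x → OnSide y → OnSide z → VStruct G D x y z →
    VStruct Gₐ (restrict D) x y z
  vstruct-restrict D sx sy sz (p , q , ne , nE) = (p , sx , sy) , (q , sz , sy) , ne , (λ e → nE (proj₁ e))

  vstruct-extend : ∀ (D : DAG G) {x y z} → VStruct Gₐ (restrict D) x y z → VStruct G D x y z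
  vstruct-extend D ((p , sx , _) , (q , sz , _) , ne , nE) = p , q , ne , (λ e → nE (e , sx , sz))

  markov-restrict : ∀ (D D' : DAG G) → MarkovEq G D D' → MarkovEq Gₐ (restrict D) (restrict D')
  markov-restrict D D' m x y z = mk⇔ (f D D' m) (f D' D (OnG.markov-sym D D' m))
    where
    f : ∀ D D' → MarkovEq G D D' → VStruct Gₐ (restrict D) x y z → VStruct Gₐ (restrict D') x y z
    f D D' m v@((_ , sx , sy) , (_ , sz , _) , _) = vstruct-restrict D' sx sy sz (to (m x y z) (vstruct-extend D v))

module Gluing {n : ℕ} (G : Graph n) (T : IsTree G) (r₁ r₂ : Fin n) (bridge : E G r₁ r₂) where
  open TreeDAGs G T
  module Side₁ = SideOf G T r₁ r₂ bridge
  module Side₂ = SideOf G T r₂ r₁ (edge-sym bridge)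
  G₁ G₂ : Graph n
  G₁ = Side₁.Gₐ
  G₂ = Side₂.Gₐ
  OnSide₁ OnSide₂ : Fin n → Set
  OnSide₁ = Side₁.OnSide
  OnSide₂ = Side₂.OnSide

  r₁≢r₂ : r₁ ≢ r₂
  r₁≢r₂ = adjacent⇒≢ bridge

  sides₁₂-disjoint : ∀ {x} → OnSide₁ x → OnSide₂ x → ⊥
  sides₁₂-disjoint = sides-disjoint bridge

  BridgeArc : Bool → Fin n → Fin n → Set
  BridgeArc true u v = u ≡ r₁ × v ≡ r₂
  BridgeArc false u v = u ≡ r₂ × v ≡ r₁

  Oriented : Bool → DAG G → Set
  Oriented true D = OnG.Arc D r₁ r₂
  Oriented false D = OnG.Arc D r₂ r₁

  bridgeArc⇒edge : ∀ o {u v} → BridgeArc o u v → E G u v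
  bridgeArc⇒edge true (refl , refl) = bridge
  bridgeArc⇒edge false (refl , refl) = edge-sym bridge

  bridgeArc-off₁ : ∀ o {u v} → BridgeArc o u v → OnSide₁ u → OnSide₁ v → ⊥
  bridgeArc-off₁ true (refl , refl) su sv = Side₁.b-offSide sv
  bridgeArc-off₁ false (refl , refl) su sv = Side₁.b-offSide su
  bridgeArc-off₂ : ∀ o {u v} → BridgeArc o u v → OnSide₂ u → OnSide₂ v → ⊥
  bridgeArc-off₂ true (refl , refl) su sv = Side₂.b-offSide su
  bridgeArc-off₂ false (refl , refl) su sv = Side₂.b-offSide sv

  bridgeArc-asym : ∀ o {u v} → BridgeArc o u v → BridgeArc o v u → ⊥
  bridgeArc-asym true (refl , refl) (e , _) = r₁≢r₂ (sym e)
  bridgeArc-asym false (refl , refl) (e , _) = r₁≢r₂ e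

  bridgeArc-orient : ∀ o {u v} → u ≡ r₁ → v ≡ r₂ → BridgeArc o u v ⊎ BridgeArc o v u
  bridgeArc-orient true p q = inj₁ (p , q)
  bridgeArc-orient false p q = inj₂ (q , p)

  module Glue (D₁ : DAG G₁) (D₂ : DAG G₂) (o : Bool) where
    GluedArc : Fin n → Fin n → Set
    GluedArc u v = Side₁.Arcₐ D₁ u v ⊎ Side₂.Arcₐ D₂ u v ⊎ BridgeArc o u v

    glued⇒edge : ∀ {u v} → GluedArc u v → E G u v
    glued⇒edge (inj₁ d) = proj₁ (Side₁.OnGₐ.arc⇒edge D₁ d)
    glued⇒edge (inj₂ (inj₁ d)) = proj₁ (Side₂.OnGₐ.arc⇒edge D₂ d)
    glued⇒edge (inj₂ (inj₂ p)) = bridgeArc⇒edge o p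

    arc₁-onSide : ∀ {u v} → Side₁.Arcₐ D₁ u v → OnSide₁ u × OnSide₁ v
    arc₁-onSide d = proj₂ (Side₁.OnGₐ.arc⇒edge D₁ d)
    arc₂-onSide : ∀ {u v} → Side₂.Arcₐ D₂ u v → OnSide₂ u × OnSide₂ v
    arc₂-onSide d = proj₂ (Side₂.OnGₐ.arc⇒edge D₂ d)

    glued-asym : ∀ {u v} → GluedArc u v → GluedArc v u → ⊥
    glued-asym (inj₁ d) (inj₁ d') = Side₁.OnGₐ.arc-asym D₁ d d'
    glued-asym (inj₁ d) (inj₂ (inj₁ d')) = sides₁₂-disjoint (proj₁ (arc₁-onSide d)) (proj₂ (arc₂-onSide d'))
    glued-asym (inj₁ d) (inj₂ (inj₂ p)) = bridgeArc-off₁ o p (proj₂ (arc₁-onSide d)) (proj₁ (arc₁-onSide d))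
    glued-asym (inj₂ (inj₁ d)) (inj₁ d') = sides₁₂-disjoint (proj₂ (arc₁-onSide d')) (proj₁ (arc₂-onSide d))
    glued-asym (inj₂ (inj₁ d)) (inj₂ (inj₁ d')) = Side₂.OnGₐ.arc-asym D₂ d d'
    glued-asym (inj₂ (inj₁ d)) (inj₂ (inj₂ p)) = bridgeArc-off₂ o p (proj₂ (arc₂-onSide d)) (proj₁ (arc₂-onSide d))
    glued-asym (inj₂ (inj₂ p)) (inj₁ d) = bridgeArc-off₁ o p (proj₂ (arc₁-onSide d)) (proj₁ (arc₁-onSide d))
    glued-asym (inj₂ (inj₂ p)) (inj₂ (inj₁ d)) = bridgeArc-off₂ o p (proj₂ (arc₂-onSide d)) (proj₁ (arc₂-onSide d))
    glued-asym (inj₂ (inj₂ p)) (inj₂ (inj₂ q)) = bridgeArc-asym o p q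

    glued-orient : ∀ u v → E G u v → GluedArc u v ⊎ GluedArc v u
    glued-orient u v e with ≟-pair u v r₁ r₂ | ≟-pair u v r₂ r₁
    ... | yes (p , q) | _ = Sum.map (λ x → inj₂ (inj₂ x)) (λ x → inj₂ (inj₂ x)) (bridgeArc-orient o p q)
    ... | no _ | yes (p , q) = Sum.swap (Sum.map (λ x → inj₂ (inj₂ x)) (λ x → inj₂ (inj₂ x))
          (bridgeArc-orient o {v} {u} q p))
    ... | no np | no nq with side-cover bridge (proj₁ (edge-vertices e))
    ... | inj₁ su with side-step e su
    ... | inj₂ pq = ⊥-elim (np pq)
    ... | inj₁ sv = Sum.map inj₁ inj₁ (Side₁.OnGₐ.orient D₁ (e , su , sv))
    glued-orient u v e | no np | no nq | inj₂ su with side-step e su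
    ... | inj₂ pq = ⊥-elim (nq pq)
    ... | inj₁ sv = Sum.map (λ x → inj₂ (inj₁ x)) (λ x → inj₂ (inj₁ x)) (Side₂.OnGₐ.orient D₂ (e , su , sv))

    glued-unorient : ∀ u v → GluedArc u v ⊎ GluedArc v u → E G u v
    glued-unorient u v (inj₁ d) = glued⇒edge d
    glued-unorient u v (inj₂ d) = edge-sym (glued⇒edge d)

    glued : DAG G
    glued = GluedArc , (λ u v → mk⇔ (glued-orient u v) (glued-unorient u v)) , (λ u v p → glued-asym (proj₁ p) (proj₂ p)) ,
        acyclic-orientation
        GluedArc glued⇒edge glued-asym

    restrict₁-glued : ∀ u v → Side₁.Arcₐ (Side₁.restrict glued) u v ⇔ Side₁.Arcₐ D₁ u v
    restrict₁-glued u v = mk⇔ f (λ d → inj₁ d , arc₁-onSide d)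
      where
      f : Side₁.Arcₐ (Side₁.restrict glued) u v → Side₁.Arcₐ D₁ u v
      f (inj₁ d , _) = d
      f (inj₂ (inj₁ d) , su , _) = ⊥-elim (sides₁₂-disjoint su (proj₁ (arc₂-onSide d)))
      f (inj₂ (inj₂ p) , su , sv) = ⊥-elim (bridgeArc-off₁ o p su sv)

    restrict₂-glued : ∀ u v → Side₂.Arcₐ (Side₂.restrict glued) u v ⇔ Side₂.Arcₐ D₂ u v
    restrict₂-glued u v = mk⇔ f (λ d → inj₂ (inj₁ d) , arc₂-onSide d)
      where
      f : Side₂.Arcₐ (Side₂.restrict glued) u v → Side₂.Arcₐ D₂ u v
      f (inj₁ d , su , _) = ⊥-elim (sides₁₂-disjoint (proj₁ (arc₁-onSide d)) su)
      f (inj₂ (inj₁ d) , _) = d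
      f (inj₂ (inj₂ p) , su , sv) = ⊥-elim (bridgeArc-off₂ o p su sv)

  glue-bridge : ∀ D₁ D₂ o → Oriented o (Glue.glued D₁ D₂ o)
  glue-bridge D₁ D₂ true = inj₂ (inj₂ (refl , refl))
  glue-bridge D₁ D₂ false = inj₂ (inj₂ (refl , refl))

  glue : DAG G₁ → DAG G₂ → Bool → DAG G
  glue = Glue.glued

  BridgeV₁ : DAG G → Fin n → Set
  BridgeV₁ D x = VStruct G D r₂ r₁ x
  BridgeV₂ : DAG G → Fin n → Set
  BridgeV₂ D y = VStruct G D r₁ r₂ y

  markov⇒parts : ∀ (D D' : DAG G) → MarkovEq G D D' →
    MarkovEq G₁ (Side₁.restrict D) (Side₁.restrict D') × MarkovEq G₂ (Side₂.restrict D) (Side₂.restrict D') ×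
    (∀ x → BridgeV₁ D x ⇔ BridgeV₁ D' x) × (∀ y → BridgeV₂ D y ⇔ BridgeV₂ D' y)
  markov⇒parts D D' m = Side₁.markov-restrict D D' m , Side₂.markov-restrict D D' m , (λ x → m r₂ r₁ x) , (λ y → m r₁ r₂ y)

  private
    vstruct-transfer : ∀ (D D' : DAG G) → MarkovEq G₁ (Side₁.restrict D) (Side₁.restrict D') →
      MarkovEq G₂ (Side₂.restrict D) (Side₂.restrict D') →
      (∀ x → BridgeV₁ D x → BridgeV₁ D' x) → (∀ y → BridgeV₂ D y → BridgeV₂ D' y) →
      ∀ x y z → VStruct G D x y z → VStruct G D' x y z
    vstruct-transfer D D' m1 m2 b1 b2 x y z vs@(xy , zy , ne , nE)
      with side-cover bridge (proj₂ (edge-vertices (OnG.arc⇒edge D xy)))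
    ... | inj₁ sy with side-step (edge-sym (OnG.arc⇒edge D xy)) sy | side-step (edge-sym (OnG.arc⇒edge D zy)) sy
    ... | inj₁ sx | inj₁ sz = Side₁.vstruct-extend D' (to (m1 x y z) (Side₁.vstruct-restrict D sx sy sz vs))
    ... | inj₂ (refl , refl) | _ = b1 z vs
    ... | inj₁ sx | inj₂ (refl , refl) = vstruct-swap G edge-sym D' (b1 x (vstruct-swap G edge-sym D vs))
    vstruct-transfer D D' m1 m2 b1 b2 x y z vs@(xy , zy , ne , nE) | inj₂ sy
      with side-step (edge-sym (OnG.arc⇒edge D xy)) sy | side-step (edge-sym (OnG.arc⇒edge D zy)) sy
    ... | inj₁ sx | inj₁ sz = Side₂.vstruct-extend D' (to (m2 x y z) (Side₂.vstruct-restrict D sx sy sz vs))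
    ... | inj₂ (refl , refl) | _ = b2 z vs
    ... | inj₁ sx | inj₂ (refl , refl) = vstruct-swap G edge-sym D' (b2 x (vstruct-swap G edge-sym D vs))

  -- Every v-structure lies inside one side or is collided at r₁ or r₂ with the bridge as an arm.
  parts⇒markov : ∀ (D D' : DAG G) → MarkovEq G₁ (Side₁.restrict D) (Side₁.restrict D') →
    MarkovEq G₂ (Side₂.restrict D) (Side₂.restrict D') →
    (∀ x → BridgeV₁ D x ⇔ BridgeV₁ D' x) → (∀ y → BridgeV₂ D y ⇔ BridgeV₂ D' y) → MarkovEq G D D'
  parts⇒markov D D' m1 m2 b1 b2 x y z =
    mk⇔ (vstruct-transfer D D' m1 m2 (λ x → to (b1 x)) (λ y → to (b2 y)) x y z)
        (vstruct-transfer D' D (Side₁.OnGₐ.markov-sym (Side₁.restrict D) (Side₁.restrict D') m1)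
              (Side₂.OnGₐ.markov-sym (Side₂.restrict D) (Side₂.restrict D') m2) (λ x → from (b1 x)) (λ y → from (b2 y)) x y
                  z)

module Decomposition {n : ℕ} (G : Graph n) (T : IsTree G) (r₁ r₂ : Fin n) (bridge : E G r₁ r₂) where
  open Gluing G T r₁ r₂ bridge public
  open TreeDAGs G T using (module OnG; edge-sym; triangle-free; side-step; adjacent⇒≢) public
  module OnG₁ = Side₁.OnGₐ
  module OnG₂ = Side₂.OnGₐ
  restrict₁ : DAG G → DAG G₁
  restrict₁ = Side₁.restrict
  restrict₂ : DAG G → DAG G₂
  restrict₂ = Side₂.restrict
  Arc₁ : DAG G₁ → Fin n → Fin n → Set
  Arc₁ = Side₁.Arcₐ
  Arc₂ : DAG G₂ → Fin n → Fin n → Set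
  Arc₂ = Side₂.Arcₐ

  record Realises (b1 : DAG G₁) (p1 : ParentRule n) (b2 : DAG G₂) (p2 : ParentRule n) (o : Bool) (D : DAG G) : Set where
    constructor realises
    field
      markov₁ : MarkovEq G₁ b1 (restrict₁ D)
      obeys₁ : OnG₁.Obeys (restrict₁ D) r₁ p1
      markov₂ : MarkovEq G₂ b2 (restrict₂ D)
      obeys₂ : OnG₂.Obeys (restrict₂ D) r₂ p2
      oriented : Oriented o D

  -- In an admissible description the parent rule of the root the bridge points into is left free
  -- only if that root already has a compelled parent on its own side.
  Admissible : DAG G₁ → ParentRule n → DAG G₂ → ParentRule n → Bool → Set₁
  Admissible b1 p1 b2 p2 o = (o ≡ false → p1 ≡ anyParents → IntoR G₁ r₁ b1) × (o ≡ true → p2 ≡ anyParents → IntoR G₂ r₂ b2)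

  restrict₁-parent : ∀ (D : DAG G) {x} → x ≢ r₂ → OnG.Arc D x r₁ ⇔ Arc₁ (restrict₁ D) x r₁
  restrict₁-parent D ne = mk⇔ (λ d → d , Side₁.neighbour-inSide (edge-sym (OnG.arc⇒edge D d)) ne , ε) proj₁
  restrict₂-parent : ∀ (D : DAG G) {x} → x ≢ r₁ → OnG.Arc D x r₂ ⇔ Arc₂ (restrict₂ D) x r₂
  restrict₂-parent D ne = mk⇔ (λ d → d , Side₂.neighbour-inSide (edge-sym (OnG.arc⇒edge D d)) ne , ε) proj₁

  bridgeV₁⇔ : ∀ (D : DAG G) x → BridgeV₁ D x ⇔ (OnG.Arc D r₂ r₁ × OnG.Arc D x r₁ × x ≢ r₂)
  bridgeV₁⇔ D x = mk⇔ (λ { (p , q , ne , _) → p , q , (λ e → ne (sym e)) })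
    (λ { (p , q , ne) → p , q , (λ e → ne (sym e)) , triangle-free (OnG.arc⇒edge D p) (edge-sym (OnG.arc⇒edge D q))
          (λ e → ne (sym e)) })
  bridgeV₂⇔ : ∀ (D : DAG G) y → BridgeV₂ D y ⇔ (OnG.Arc D r₁ r₂ × OnG.Arc D y r₂ × y ≢ r₁)
  bridgeV₂⇔ D y = mk⇔ (λ { (p , q , ne , _) → p , q , (λ e → ne (sym e)) })
    (λ { (p , q , ne) → p , q , (λ e → ne (sym e)) , triangle-free (OnG.arc⇒edge D p) (edge-sym (OnG.arc⇒edge D q))
          (λ e → ne (sym e)) })

  out⇒¬in : ∀ (D : DAG G) → Oriented true D → ¬ OnG.Arc D r₂ r₁
  out⇒¬in D d d' = OnG.arc-asym D d d'
  in⇒¬out : ∀ (D : DAG G) → Oriented false D → ¬ OnG.Arc D r₁ r₂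
  in⇒¬out D d d' = OnG.arc-asym D d d'

  markov₁-via : ∀ b1 (D D' : DAG G) → MarkovEq G₁ b1 (restrict₁ D) → MarkovEq G₁ b1 (restrict₁ D') →
    MarkovEq G₁ (restrict₁ D) (restrict₁ D')
  markov₁-via b1 D D' m m' = OnG₁.markov-trans (restrict₁ D) b1 (restrict₁ D') (OnG₁.markov-sym b1 (restrict₁ D) m) m'
  markov₂-via : ∀ b2 (D D' : DAG G) → MarkovEq G₂ b2 (restrict₂ D) → MarkovEq G₂ b2 (restrict₂ D') →
    MarkovEq G₂ (restrict₂ D) (restrict₂ D')
  markov₂-via b2 D D' m m' = OnG₂.markov-trans (restrict₂ D) b2 (restrict₂ D') (OnG₂.markov-sym b2 (restrict₂ D) m) m'

  bridgeV₁-agree : ∀ o (D D' : DAG G) → Oriented o D → Oriented o D' →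
    (o ≡ false → ∀ x → ¬ ¬ (Arc₁ (restrict₁ D) x r₁ ⇔ Arc₁ (restrict₁ D') x r₁)) → ∀ x → ¬ ¬ (BridgeV₁ D x ⇔ BridgeV₁ D' x)
  bridgeV₁-agree true D D' d d' h x = return
      (mk⇔ (λ b → ⊥-elim (out⇒¬in D d (proj₁ b))) (λ b → ⊥-elim (out⇒¬in D' d' (proj₁ b))))
  bridgeV₁-agree false D D' d d' h x = h refl x >>= λ eq →
      return (mk⇔ (λ b → let (p , q , ne) = to (bridgeV₁⇔ D x) b in
                  from (bridgeV₁⇔ D' x) (d' , from (restrict₁-parent D' ne) (to eq (to (restrict₁-parent D ne) q)) , ne))
               (λ b → let (p , q , ne) = to (bridgeV₁⇔ D' x) b in
                  from (bridgeV₁⇔ D x) (d , from (restrict₁-parent D ne) (from eq (to (restrict₁-parent D' ne) q)) , ne)))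

  bridgeV₂-agree : ∀ o (D D' : DAG G) → Oriented o D → Oriented o D' →
    (o ≡ true → ∀ y → ¬ ¬ (Arc₂ (restrict₂ D) y r₂ ⇔ Arc₂ (restrict₂ D') y r₂)) → ∀ y → ¬ ¬ (BridgeV₂ D y ⇔ BridgeV₂ D' y)
  bridgeV₂-agree false D D' d d' h y = return
      (mk⇔ (λ b → ⊥-elim (in⇒¬out D d (proj₁ b))) (λ b → ⊥-elim (in⇒¬out D' d' (proj₁ b))))
  bridgeV₂-agree true D D' d d' h y = h refl y >>= λ eq →
      return (mk⇔ (λ b → let (p , q , ne) = to (bridgeV₂⇔ D y) b in
                  from (bridgeV₂⇔ D' y) (d' , from (restrict₂-parent D' ne) (to eq (to (restrict₂-parent D ne) q)) , ne))
               (λ b → let (p , q , ne) = to (bridgeV₂⇔ D' y) b in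
                  from (bridgeV₂⇔ D y) (d , from (restrict₂-parent D ne) (from eq (to (restrict₂-parent D' ne) q)) , ne)))

  realises-markov : ∀ {b1 p1 b2 p2} o (D D' : DAG G) → Admissible b1 p1 b2 p2 o → Realises b1 p1 b2 p2 o D →
    Realises b1 p1 b2 p2 o D' →
    ¬ ¬ (MarkovEq G D D')
  realises-markov {b1} {p1} {b2} {p2} o D D' (v1 , v2) (realises m1 q1 m2 q2 d) (realises m1' q1' m2' q2' d') =
    ¬¬-Π-Fin n (bridgeV₁-agree o D D' d d' (λ e → OnG₁.parents-agree (restrict₁ D) (restrict₁ D') p1 mm1 q1 q1'
                    (λ e' → OnG₁.intoR-markov b1 (restrict₁ D) m1 (v1 e e')))) >>= λ ba →
    ¬¬-Π-Fin n (bridgeV₂-agree o D D' d d' (λ e → OnG₂.parents-agree (restrict₂ D) (restrict₂ D') p2 mm2 q2 q2'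
                    (λ e' → OnG₂.intoR-markov b2 (restrict₂ D) m2 (v2 e e')))) >>= λ bb →
    return (parts⇒markov D D' mm1 mm2 ba bb)
    where
    mm1 : MarkovEq G₁ (restrict₁ D) (restrict₁ D')
    mm1 = markov₁-via b1 D D' m1 m1'
    mm2 : MarkovEq G₂ (restrict₂ D) (restrict₂ D')
    mm2 = markov₂-via b2 D D' m2 m2'

  glue-realises : ∀ (D₁ : DAG G₁) (D₂ : DAG G₂) o {b1 p1 b2 p2} → MarkovEq G₁ b1 D₁ → OnG₁.Obeys D₁ r₁ p1 →
    MarkovEq G₂ b2 D₂ → OnG₂.Obeys D₂ r₂ p2 → Realises b1 p1 b2 p2 o (glue D₁ D₂ o)
  glue-realises D₁ D₂ o {b1} {p1} {b2} {p2} m1 q1 m2 q2 =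
    realises (OnG₁.markov-trans b1 D₁ (restrict₁ g) m1
          (same-arcs⇒markov G₁ D₁ (restrict₁ g) (λ u v → ⇔-sym (Glue.restrict₁-glued D₁ D₂ o u v))))
    (OnG₁.obeys-transport D₁ (restrict₁ g) p1 (λ u v → ⇔-sym (Glue.restrict₁-glued D₁ D₂ o u v)) q1)
    (OnG₂.markov-trans b2 D₂ (restrict₂ g) m2
          (same-arcs⇒markov G₂ D₂ (restrict₂ g) (λ u v → ⇔-sym (Glue.restrict₂-glued D₁ D₂ o u v))))
    (OnG₂.obeys-transport D₂ (restrict₂ g) p2 (λ u v → ⇔-sym (Glue.restrict₂-glued D₁ D₂ o u v)) q2)
    (glue-bridge D₁ D₂ o)
    where g = glue D₁ D₂ o

  onSide₁⇒≢r₂ : ∀ {x} → OnSide₁ x → x ≢ r₂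
  onSide₁⇒≢r₂ s refl = Side₁.b-offSide s
  onSide₂⇒≢r₁ : ∀ {x} → OnSide₂ x → x ≢ r₁
  onSide₂⇒≢r₁ s refl = Side₂.b-offSide s

  intoR₁⇒intoR : ∀ (D : DAG G) → IntoR G₁ r₁ (restrict₁ D) → ¬ ¬ (IntoR G r₁ D)
  intoR₁⇒intoR D (x , dx) = OnG₁.directed⇒compelled (restrict₁ D) dx >>= λ c → return
      (x , OnG.compelled⇒directed D (Compelled-map proj₁ c))

  intoR₂⇒intoR : ∀ (D : DAG G) → Oriented false D → IntoR G₂ r₂ (restrict₂ D) → ¬ ¬ (IntoR G r₁ D)
  intoR₂⇒intoR D d (x , dx) = OnG₂.directed⇒compelled (restrict₂ D) dx >>= λ c → return
      (r₂ , OnG.compelled⇒directed D (propagated d (Compelled-map proj₁ c)))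

  parent₁⇒intoR : ∀ (D : DAG G) {x} → Oriented false D → Arc₁ (restrict₁ D) x r₁ → IntoR G r₁ D
  parent₁⇒intoR D d (xr , sx , _) = OnG.two-parents⇒intoR D xr d (onSide₁⇒≢r₂ sx)

  ¬intoR⇒¬intoR₁ : ∀ (D : DAG G) → ¬ IntoR G r₁ D → ¬ IntoR G₁ r₁ (restrict₁ D)
  ¬intoR⇒¬intoR₁ D ni ii = intoR₁⇒intoR D ii ni

  ¬intoR⇒¬intoR₂ : ∀ (D : DAG G) → Oriented false D → ¬ IntoR G r₁ D → ¬ IntoR G₂ r₂ (restrict₂ D)
  ¬intoR⇒¬intoR₂ D d ni ii = intoR₂⇒intoR D d ii ni

  ¬intoR⇒parentless₁ : ∀ (D : DAG G) → Oriented false D → ¬ IntoR G r₁ D → ∀ a → ¬ Arc₁ (restrict₁ D) a r₁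
  ¬intoR⇒parentless₁ D d ni a p = ni (parent₁⇒intoR D d p)

  out-¬intoR₁⇒¬intoR : ∀ (D : DAG G) → Oriented true D → ¬ IntoR G₁ r₁ (restrict₁ D) → ¬ IntoR G r₁ D
  out-¬intoR₁⇒¬intoR D d ni1 (x , dx) = OnG.directed⇒compelled D dx λ c → f c
    where
    f : Compelled (OnG.Arc D) x r₁ → ⊥
    f c with x ≟ r₂
    ... | yes refl = out⇒¬in D d (compelled⇒arc c)
    ... | no ne with Side₁.compelled-restrict D c (Side₁.neighbour-inSide (edge-sym (OnG.arc⇒edge D (compelled⇒arc c))) ne) ε
    ... | inj₁ c1 = ni1 (x , OnG₁.compelled⇒directed (restrict₁ D) c1)
    ... | inj₂ c2 = out⇒¬in D d (compelled⇒arc c2)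

  in-¬intoR₂⇒¬intoR : ∀ (D : DAG G) → Oriented false D → ¬ IntoR G₂ r₂ (restrict₂ D) → (∀ a → ¬ Arc₁ (restrict₁ D) a r₁) →
    ¬ IntoR G r₁ D
  in-¬intoR₂⇒¬intoR D d ni2 np (x , dx) = OnG.directed⇒compelled D dx λ c → f c
    where
    f : Compelled (OnG.Arc D) x r₁ → ⊥
    f c with x ≟ r₂
    f (v-struct {y = y} _ yr ne) | yes refl with y ≟ r₂
    ... | yes refl = ne refl
    ... | no ne' = np _ (to (restrict₁-parent D ne') yr)
    f (propagated _ cw) | yes refl with Side₂.compelled-restrict D cw
        (Side₂.neighbour-inSide (edge-sym (OnG.arc⇒edge D (compelled⇒arc cw)))
              (λ e → OnG.arc-asym D d (subst (λ z → OnG.Arc D z r₂) e (compelled⇒arc cw)))) ε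
    ... | inj₁ c2 = ni2 (_ , OnG₂.compelled⇒directed (restrict₂ D) c2)
    ... | inj₂ c1 = in⇒¬out D d (compelled⇒arc c1)
    f c | no ne = np x (to (restrict₁-parent D ne) (compelled⇒arc c))

  undirected⇒undirected₁ : ∀ (D : DAG G) → Oriented true D → ∀ x → x ≢ r₂ → Undirected G D r₁ x →
    ¬ ¬ (Undirected G₁ (restrict₁ D) r₁ x)
  undirected⇒undirected₁ D d x ne u@((D' , _ , rx) , _) =
    OnG₁.¬compelled⇒undirected (restrict₁ D) (OnG.arc⇒edge D' rx , ε , Side₁.neighbour-inSide (OnG.arc⇒edge D' rx) ne)
      (λ c → OnG.undirected⇒¬compelled D u (Compelled-map proj₁ c))
      (λ c → OnG.undirected⇒¬compelled D (proj₂ u , proj₁ u) (Compelled-map proj₁ c))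

  undirected₁⇒undirected : ∀ (D : DAG G) → Oriented true D → ∀ x → Undirected G₁ (restrict₁ D) r₁ x →
    ¬ ¬ (Undirected G D r₁ x)
  undirected₁⇒undirected D d x u@((D' , _ , rx) , _) =
    OnG.¬compelled⇒undirected D (proj₁ (OnG₁.arc⇒edge D' rx)) f g
    where
    sx : OnSide₁ x
    sx = proj₂ (proj₂ (OnG₁.arc⇒edge D' rx))
    f : ¬ Compelled (OnG.Arc D) r₁ x
    f c with Side₁.compelled-restrict D c ε sx
    ... | inj₁ c1 = OnG₁.undirected⇒¬compelled (restrict₁ D) u c1
    ... | inj₂ c2 = out⇒¬in D d (compelled⇒arc c2)
    g : ¬ Compelled (OnG.Arc D) x r₁
    g c with Side₁.compelled-restrict D c sx ε
    ... | inj₁ c1 = OnG₁.undirected⇒¬compelled (restrict₁ D) (proj₂ u , proj₁ u) c1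
    ... | inj₂ c2 = out⇒¬in D d (compelled⇒arc c2)

  ¬undirected-bridge : ∀ (D : DAG G) → Oriented true D → ∀ {y} → Arc₂ (restrict₂ D) y r₂ → ¬ Undirected G D r₁ r₂
  ¬undirected-bridge D d (yr , sy , _) u = OnG.undirected⇒¬compelled D u (v-struct d yr (onSide₂⇒≢r₁ sy))

  undirected-bridge : ∀ (D : DAG G) → Oriented true D → (∀ a → ¬ Arc₂ (restrict₂ D) a r₂) → ¬ IntoR G r₁ D →
    ¬ ¬ (Undirected G D r₁ r₂)
  undirected-bridge D d np ni = OnG.¬compelled⇒undirected D bridge f g
    where
    f : ¬ Compelled (OnG.Arc D) r₁ r₂
    f (v-struct _ yr ne) = np _ (to (restrict₂-parent D ne) yr)
    f (propagated _ c) = ni (_ , OnG.compelled⇒directed D c)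
    g : ¬ Compelled (OnG.Arc D) r₂ r₁
    g c = out⇒¬in D d (compelled⇒arc c)

  intoR⇒parent₂ : ∀ (D₂ : DAG G₂) → IntoR G₂ r₂ D₂ → Σ (Fin n) λ y → Arc₂ D₂ y r₂
  intoR⇒parent₂ D₂ (y , dy) = y , OnG₂.directed⇒arc D₂ dy

  -- With no arc into r₁, first make r₂ parentless on its own side; then flipping r₂ → r₁
  -- creates no v-structure at r₂ and destroys none at r₁.
  reorient-bridge : ∀ (D : DAG G) → Oriented false D → ¬ IntoR G r₁ D →
    ¬ ¬ (Σ (DAG G) λ D' → MarkovEq G D D' × Oriented true D')
  reorient-bridge D d ni = OnG₂.parentless-member (restrict₂ D) (¬intoR⇒¬intoR₂ D d ni) >>= λ
    { (N₂ , m₂ , np) → return (glue (restrict₁ D) N₂ true , flipped-markov N₂ m₂ np , glue-bridge (restrict₁ D) N₂ true) }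
    where
    flipped-markov : (N₂ : DAG G₂) → MarkovEq G₂ (restrict₂ D) N₂ → (∀ a → ¬ Arc₂ N₂ a r₂) →
      MarkovEq G D (glue (restrict₁ D) N₂ true)
    flipped-markov N₂ m₂ np = parts⇒markov D g mm₁ mm₂
      (λ x → mk⇔ (λ b → let (p , q , ne) = to (bridgeV₁⇔ D x) b in ⊥-elim (¬intoR⇒parentless₁ D d ni x (to (restrict₁-parent D ne) q)))
                 (λ b → ⊥-elim (out⇒¬in g (glue-bridge (restrict₁ D) N₂ true) (proj₁ b))))
      (λ y → mk⇔ (λ b → ⊥-elim (in⇒¬out D d (proj₁ b)))
                 (λ b → let (p , q , ne) = to (bridgeV₂⇔ g y) b in ⊥-elim (np y (to (Glue.restrict₂-glued (restrict₁ D) N₂ true y r₂)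
                          (to (restrict₂-parent g ne) q)))))
      where
      g : DAG G
      g = glue (restrict₁ D) N₂ true
      mm₁ : MarkovEq G₁ (restrict₁ D) (restrict₁ g)
      mm₁ = same-arcs⇒markov G₁ (restrict₁ D) (restrict₁ g) (λ u v → ⇔-sym (Glue.restrict₁-glued (restrict₁ D) N₂ true u v))
      mm₂ : MarkovEq G₂ (restrict₂ D) (restrict₂ g)
      mm₂ = OnG₂.markov-trans (restrict₂ D) N₂ (restrict₂ g) m₂
        (same-arcs⇒markov G₂ N₂ (restrict₂ g) (λ u v → ⇔-sym (Glue.restrict₂-glued (restrict₁ D) N₂ true u v)))

module Formulas {n : ℕ} (G : Graph n) (r₁ r₂ : Fin n) (T : IsTree G) (bridge : E G r₁ r₂)
  (δ δ₂ : ℕ) (deg : Degree G r₁ δ) (deg₂ : Degree (component G r₂ r₁) r₂ δ₂)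
  (a₁ : ℕ) (b₁ : ℕ → ℕ) (a₂ c₂ : ℕ) (b₂ : ℕ → ℕ)
  (sysA₁ : N1 (component G r₁ r₂) r₁ a₁) (sysB₁ : ∀ i → N0i (component G r₁ r₂) r₁ i (b₁ i))
  (sysA₂ : N1 (component G r₂ r₁) r₂ a₂) (sysC₂ : N0 (component G r₂ r₁) r₂ c₂)
  (sysB₂ : ∀ j → N0i (component G r₂ r₁) r₂ j (b₂ j)) where

  open Decomposition G T r₁ r₂ bridge public

  into₁ : Fin a₁ → DAG G₁
  into₁ = proj₁ sysA₁
  into₁-intoR : ∀ k → IntoR G₁ r₁ (into₁ k)
  into₁-intoR = proj₁ (proj₂ sysA₁)
  into₁-injective : ∀ k k' → MarkovEq G₁ (into₁ k) (into₁ k') → k ≡ k'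
  into₁-injective = proj₁ (proj₂ (proj₂ sysA₁))

  prof₁ : ∀ i → Fin (b₁ i) → DAG G₁
  prof₁ i = proj₁ (sysB₁ i)
  prof₁-profile : ∀ i k → ProfileAt G₁ r₁ i (prof₁ i k)
  prof₁-profile i = proj₁ (proj₂ (sysB₁ i))
  prof₁-injective : ∀ i k k' → MarkovEq G₁ (prof₁ i k) (prof₁ i k') → k ≡ k'
  prof₁-injective i = proj₁ (proj₂ (proj₂ (sysB₁ i)))
  prof₁-¬intoR : ∀ i k → ¬ IntoR G₁ r₁ (prof₁ i k)
  prof₁-¬intoR i k = proj₁ (prof₁-profile i k)
  prof₁-count : ∀ i k → CountFin (λ x → Undirected G₁ (prof₁ i k) r₁ x) i
  prof₁-count i k = proj₂ (proj₂ (prof₁-profile i k))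
  nbr₁ : ∀ i k → Fin i → Fin n
  nbr₁ i k = proj₁ (prof₁-count i k)
  nbr₁-undirected : ∀ i k t → Undirected G₁ (prof₁ i k) r₁ (nbr₁ i k t)
  nbr₁-undirected i k = proj₁ (proj₂ (prof₁-count i k))
  nbr₁-injective : ∀ i k t t' → nbr₁ i k t ≡ nbr₁ i k t' → t ≡ t'
  nbr₁-injective i k = proj₁ (proj₂ (proj₂ (prof₁-count i k)))

  into₂ : Fin a₂ → DAG G₂
  into₂ = proj₁ sysA₂
  into₂-intoR : ∀ k → IntoR G₂ r₂ (into₂ k)
  into₂-intoR = proj₁ (proj₂ sysA₂)
  into₂-injective : ∀ k k' → MarkovEq G₂ (into₂ k) (into₂ k') → k ≡ k'
  into₂-injective = proj₁ (proj₂ (proj₂ sysA₂))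

  free₂ : Fin c₂ → DAG G₂
  free₂ = proj₁ sysC₂
  free₂-¬intoR : ∀ k → ¬ IntoR G₂ r₂ (free₂ k)
  free₂-¬intoR = proj₁ (proj₂ sysC₂)
  free₂-injective : ∀ k k' → MarkovEq G₂ (free₂ k) (free₂ k') → k ≡ k'
  free₂-injective = proj₁ (proj₂ (proj₂ sysC₂))

  prof₂ : ∀ j → Fin (b₂ j) → DAG G₂
  prof₂ j = proj₁ (sysB₂ j)
  prof₂-profile : ∀ j k → ProfileAt G₂ r₂ j (prof₂ j k)
  prof₂-profile j = proj₁ (proj₂ (sysB₂ j))
  prof₂-injective : ∀ j k k' → MarkovEq G₂ (prof₂ j k) (prof₂ j k') → k ≡ k'
  prof₂-injective j = proj₁ (proj₂ (proj₂ (sysB₂ j)))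
  prof₂-¬intoR : ∀ j k → ¬ IntoR G₂ r₂ (prof₂ j k)
  prof₂-¬intoR j k = proj₁ (prof₂-profile j k)
  prof₂-count : ∀ j k → CountFin (λ x → Undirected G₂ (prof₂ j k) r₂ x) j
  prof₂-count j k = proj₂ (proj₂ (prof₂-profile j k))
  nbr₂ : ∀ j k → Fin j → Fin n
  nbr₂ j k = proj₁ (prof₂-count j k)
  nbr₂-undirected : ∀ j k t → Undirected G₂ (prof₂ j k) r₂ (nbr₂ j k t)
  nbr₂-undirected j k = proj₁ (proj₂ (prof₂-count j k))
  nbr₂-injective : ∀ j k t t' → nbr₂ j k t ≡ nbr₂ j k t' → t ≡ t'
  nbr₂-injective j k = proj₁ (proj₂ (proj₂ (prof₂-count j k)))

  into₁≉prof₁ : ∀ {k i k'} → MarkovEq G₁ (into₁ k) (prof₁ i k') → ⊥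
  into₁≉prof₁ {k} {i} {k'} m = prof₁-¬intoR i k' (OnG₁.intoR-markov (into₁ k) (prof₁ i k') m (into₁-intoR k))
  prof₁-index-unique : ∀ {i k i' k'} → MarkovEq G₁ (prof₁ i k) (prof₁ i' k') → i ≡ i'
  prof₁-index-unique {i} {k} {i'} {k'} m = countFin-unique (prof₁-count i k) (prof₁-count i' k')
      (λ x → OnG₁.undirected-markov (prof₁ i k) (prof₁ i' k') m)
    (λ x → OnG₁.undirected-markov (prof₁ i' k') (prof₁ i k) (OnG₁.markov-sym (prof₁ i k) (prof₁ i' k') m))
  into₂≉prof₂ : ∀ {k j k'} → MarkovEq G₂ (into₂ k) (prof₂ j k') → ⊥
  into₂≉prof₂ {k} {j} {k'} m = prof₂-¬intoR j k' (OnG₂.intoR-markov (into₂ k) (prof₂ j k') m (into₂-intoR k))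
  into₂≉free₂ : ∀ {k k'} → MarkovEq G₂ (into₂ k) (free₂ k') → ⊥
  into₂≉free₂ {k} {k'} m = free₂-¬intoR k' (OnG₂.intoR-markov (into₂ k) (free₂ k') m (into₂-intoR k))
  prof₂-index-unique : ∀ {j k j' k'} → MarkovEq G₂ (prof₂ j k) (prof₂ j' k') → j ≡ j'
  prof₂-index-unique {j} {k} {j'} {k'} m = countFin-unique (prof₂-count j k) (prof₂-count j' k')
      (λ x → OnG₂.undirected-markov (prof₂ j k) (prof₂ j' k') m)
    (λ x → OnG₂.undirected-markov (prof₂ j' k') (prof₂ j k) (OnG₂.markov-sym (prof₂ j k) (prof₂ j' k') m))

  Member₁ : DAG G₁ → ParentRule n → Set₁
  Member₁ b p = Σ (DAG G₁) λ D₁ → MarkovEq G₁ b D₁ × OnG₁.Obeys D₁ r₁ p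
  Member₂ : DAG G₂ → ParentRule n → Set₁
  Member₂ b p = Σ (DAG G₂) λ D₂ → MarkovEq G₂ b D₂ × OnG₂.Obeys D₂ r₂ p

  member₁-any : ∀ b → Member₁ b anyParents
  member₁-any b = b , OnG₁.markov-refl b , tt
  member₂-any : ∀ b → Member₂ b anyParents
  member₂-any b = b , OnG₂.markov-refl b , tt

  member₁-none : ∀ b → ¬ IntoR G₁ r₁ b → ¬ ¬ (Member₁ b noParents)
  member₁-none b ni = OnG₁.parentless-member b ni
  member₂-none : ∀ b → ¬ IntoR G₂ r₂ b → ¬ ¬ (Member₂ b noParents)
  member₂-none b ni = OnG₂.parentless-member b ni

  member₁-only : ∀ b {y} → ¬ IntoR G₁ r₁ b → Undirected G₁ b r₁ y → ¬ ¬ (Member₁ b (onlyParent y))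
  member₁-only b {y} ni u = member₁-none b ni >>= λ { (N , m , np) →
    OnG₁.single-parent-member N {r₁} {y} np (OnG₁.undirected-markov b N m u) >>= λ { (D' , m' , yr , pu) →
    return (D' , OnG₁.markov-trans b N D' m m' , yr , pu) } }
  member₂-only : ∀ b {y} → ¬ IntoR G₂ r₂ b → Undirected G₂ b r₂ y → ¬ ¬ (Member₂ b (onlyParent y))
  member₂-only b {y} ni u = member₂-none b ni >>= λ { (N , m , np) →
    OnG₂.single-parent-member N {r₂} {y} np (OnG₂.undirected-markov b N m u) >>= λ { (D' , m' , yr , pu) →
    return (D' , OnG₂.markov-trans b N D' m m' , yr , pu) } }

  record Description : Set₁ where
    constructor desc
    field
      class₁ : DAG G₁
      rule₁ : ParentRule n
      class₂ : DAG G₂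
      rule₂ : ParentRule n
      orientation : Bool
  open Description public

  RealisesD : Description → DAG G → Set₁
  RealisesD d D = Admissible (class₁ d) (rule₁ d) (class₂ d) (rule₂ d) (orientation d) × Realises (class₁ d) (rule₁ d)
      (class₂ d) (rule₂ d)
      (orientation d) D

  realise : ∀ d → Admissible (class₁ d) (rule₁ d) (class₂ d) (rule₂ d) (orientation d) → Member₁ (class₁ d) (rule₁ d) →
    Member₂ (class₂ d) (rule₂ d) →
    Σ (DAG G) λ D → RealisesD d D
  realise d v (D₁ , m1 , q1) (D₂ , m2 , q2) = glue D₁ D₂ (orientation d) , v , glue-realises D₁ D₂ (orientation d)
      {class₁ d} {rule₁ d} {class₂ d}
      {rule₂ d} m1 q1 m2 q2

  realisesD-markov : ∀ d (D D' : DAG G) → RealisesD d D → RealisesD d D' → ¬ ¬ (MarkovEq G D D')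
  realisesD-markov d D D' (v , s) (_ , s') = realises-markov {class₁ d} {rule₁ d} {class₂ d} {rule₂ d} (orientation d) D D'
      v s s'

  bridgeV₁-parent : ∀ {b1 p1 b2 p2} (D : DAG G) → Realises b1 p1 b2 p2 false D → ∀ {x} → Arc₁ (restrict₁ D) x r₁ →
    BridgeV₁ D x
  bridgeV₁-parent D (realises _ _ _ _ d) {x} (xr , sx , _) = from (bridgeV₁⇔ D x) (d , xr , onSide₁⇒≢r₂ sx)
  bridgeV₁-absent : ∀ {b1 p1 b2 p2} (D : DAG G) → Realises b1 p1 b2 p2 true D → ∀ x → ¬ BridgeV₁ D x
  bridgeV₁-absent D (realises _ _ _ _ d) x b = out⇒¬in D d (proj₁ b)
  bridgeV₁-none : ∀ {b1 b2 p2 o} (D : DAG G) → Realises b1 noParents b2 p2 o D → ∀ x → ¬ BridgeV₁ D x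
  bridgeV₁-none D (realises _ q1 _ _ _) x b with to (bridgeV₁⇔ D x) b
  ... | p , q , ne = q1 x (to (restrict₁-parent D ne) q)
  bridgeV₁-only : ∀ {b1 y b2 p2 o} (D : DAG G) → Realises b1 (onlyParent y) b2 p2 o D → ∀ x → BridgeV₁ D x → x ≡ y
  bridgeV₁-only D (realises _ (_ , pu) _ _ _) x b with to (bridgeV₁⇔ D x) b
  ... | p , q , ne = pu x (to (restrict₁-parent D ne) q)
  bridgeV₁-onlyParent : ∀ {b1 y b2 p2} (D : DAG G) → Realises b1 (onlyParent y) b2 p2 false D → BridgeV₁ D y
  bridgeV₁-onlyParent {b1} {y} {b2} {p2} D s@(realises _ (yr , _) _ _ _) = bridgeV₁-parent {b1} {onlyParent y} {b2} {p2} D s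
      yr
  bridgeV₁-any : ∀ {b1 b2 p2} (D : DAG G) → Realises b1 anyParents b2 p2 false D → IntoR G₁ r₁ b1 → Σ (Fin n) λ x →
    BridgeV₁ D x
  bridgeV₁-any {b1} {b2} {p2} D s@(realises m1 _ _ _ _) ii with OnG₁.intoR-markov b1 (restrict₁ D) m1 ii
  ... | x , dx = x , bridgeV₁-parent {b1} {anyParents} {b2} {p2} D s (OnG₁.directed⇒arc (restrict₁ D) dx)

  bridgeV₂-parent : ∀ {b1 p1 b2 p2} (D : DAG G) → Realises b1 p1 b2 p2 true D → ∀ {y} → Arc₂ (restrict₂ D) y r₂ →
    BridgeV₂ D y
  bridgeV₂-parent D (realises _ _ _ _ d) {y} (yr , sy , _) = from (bridgeV₂⇔ D y) (d , yr , onSide₂⇒≢r₁ sy)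
  bridgeV₂-none : ∀ {b1 p1 b2 o} (D : DAG G) → Realises b1 p1 b2 noParents o D → ∀ y → ¬ BridgeV₂ D y
  bridgeV₂-none D (realises _ _ _ q2 _) y b with to (bridgeV₂⇔ D y) b
  ... | p , q , ne = q2 y (to (restrict₂-parent D ne) q)
  bridgeV₂-only : ∀ {b1 p1 b2 y o} (D : DAG G) → Realises b1 p1 b2 (onlyParent y) o D → ∀ x → BridgeV₂ D x → x ≡ y
  bridgeV₂-only D (realises _ _ _ (_ , pu) _) x b with to (bridgeV₂⇔ D x) b
  ... | p , q , ne = pu x (to (restrict₂-parent D ne) q)
  bridgeV₂-onlyParent : ∀ {b1 p1 b2 y} (D : DAG G) → Realises b1 p1 b2 (onlyParent y) true D → BridgeV₂ D y
  bridgeV₂-onlyParent {b1} {p1} {b2} {y} D s@(realises _ _ _ (yr , _) _) = bridgeV₂-parent {b1} {p1} {b2} {onlyParent y} D s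
      yr
  bridgeV₂-any : ∀ {b1 p1 b2} (D : DAG G) → Realises b1 p1 b2 anyParents true D → IntoR G₂ r₂ b2 → Σ (Fin n) λ x →
    BridgeV₂ D x
  bridgeV₂-any {b1} {p1} {b2} D s@(realises _ _ m2 _ _) ii with OnG₂.intoR-markov b2 (restrict₂ D) m2 ii
  ... | x , dx = x , bridgeV₂-parent {b1} {p1} {b2} {anyParents} D s (OnG₂.directed⇒arc (restrict₂ D) dx)

  r₂-not-undirected₁ : ∀ (D₁ : DAG G₁) → ¬ Undirected G₁ D₁ r₁ r₂
  r₂-not-undirected₁ D₁ ((D' , _ , d) , _) = Side₁.b-offSide (proj₂ (proj₂ (OnG₁.arc⇒edge D' d)))

  suc≤⇒≤∸1 : ∀ {i d} → suc i ≤ d → i ≤ d ∸ 1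
  suc≤⇒≤∸1 (s≤s p) = p

  profile₁-bound : ∀ {i} (D₁ : DAG G₁) → ProfileAt G₁ r₁ i D₁ → i ≤ δ ∸ 1
  profile₁-bound D₁ (_ , _ , cf) = suc≤⇒≤∸1 (countFin-≤ (countFin-insert cf (r₂-not-undirected₁ D₁)) deg f)
    where
    f : ∀ x → Undirected G₁ D₁ r₁ x ⊎ x ≡ r₂ → E G r₁ x
    f x (inj₁ ((D' , _ , d) , _)) = proj₁ (OnG₁.arc⇒edge D' d)
    f x (inj₂ refl) = bridge

  profile₂-bound : ∀ {j} (D₂ : DAG G₂) → ProfileAt G₂ r₂ j D₂ → j ≤ δ₂
  profile₂-bound D₂ (_ , _ , cf) = countFin-≤ cf deg₂ (λ { x ((D' , _ , d) , _) → OnG₂.arc⇒edge D' d })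

  parent-index₁ : ∀ (D : DAG G) i k → MarkovEq G₁ (prof₁ i k) (restrict₁ D) → ¬ IntoR G₁ r₁ (restrict₁ D) → ∀ {x} →
    Arc₁ (restrict₁ D) x r₁ →
    ¬ ¬ (Σ (Fin i) λ t → OnG₁.Obeys (restrict₁ D) r₁ (onlyParent (nbr₁ i k t)))
  parent-index₁ D i k m ni {x} xr = OnG₁.parent⇒undirected (restrict₁ D) ni xr >>= λ u →
    let u' = OnG₁.undirected-markov (restrict₁ D) (prof₁ i k) (OnG₁.markov-sym (prof₁ i k) (restrict₁ D) m) u
        te = proj₂ (proj₂ (proj₂ (prof₁-count i k))) x u'
        t = proj₁ te
        e = proj₂ te
    in return (t , subst (λ z → Arc₁ (restrict₁ D) z r₁) (sym e) xr ,
            λ a ar → trans (OnG₁.¬intoR⇒parent-unique (restrict₁ D) ni ar xr) (sym e))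

  parent-index₂ : ∀ (D : DAG G) j k → MarkovEq G₂ (prof₂ j k) (restrict₂ D) → ¬ IntoR G₂ r₂ (restrict₂ D) → ∀ {x} →
    Arc₂ (restrict₂ D) x r₂ →
    ¬ ¬ (Σ (Fin j) λ t → OnG₂.Obeys (restrict₂ D) r₂ (onlyParent (nbr₂ j k t)))
  parent-index₂ D j k m ni {x} xr = OnG₂.parent⇒undirected (restrict₂ D) ni xr >>= λ u →
    let u' = OnG₂.undirected-markov (restrict₂ D) (prof₂ j k) (OnG₂.markov-sym (prof₂ j k) (restrict₂ D) m) u
        te = proj₂ (proj₂ (proj₂ (prof₂-count j k))) x u'
        t = proj₁ te
        e = proj₂ te
    in return (t , subst (λ z → Arc₂ (restrict₂ D) z r₂) (sym e) xr ,
            λ a ar → trans (OnG₂.¬intoR⇒parent-unique (restrict₂ D) ni ar xr) (sym e))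

  -- For a class into₁ k the
  -- summand Fin 2 (resp. Fin j ⊎ Fin 2) records the bridge direction (resp. the only parent of r₂
  -- on its side, no parent, or r₂ → r₁); for prof₁ i k the bridge points into r₁ and Fin i ⊎ Fin 1
  -- (resp. Fin i) chooses the only parent of r₁ on its side, or none when r₂ has a compelled parent.
  IndexA₂ : ℕ → Set
  IndexA₂ j = (Fin j ⊎ Fin 2) × Fin (b₂ j)
  IndexA₃ : ℕ → Set
  IndexA₃ i = Fin (b₁ i) × (((Fin i ⊎ Fin 1) × Fin a₂) ⊎ (Fin i × Fin c₂))
  IndexA : Set
  IndexA = (Fin a₁ × ((Fin 2 × Fin a₂) ⊎ SumUpTo δ₂ IndexA₂)) ⊎ SumUpTo (δ ∸ 1) IndexA₃

  orientation-bit : Fin 2 → Bool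
  orientation-bit zero = false
  orientation-bit (suc _) = true

  descA₁ : Fin a₁ → Fin 2 → Fin a₂ → Description
  descA₁ k1 u k2 = desc (into₁ k1) anyParents (into₂ k2) anyParents (orientation-bit u)
  descA₂ : Fin a₁ → ∀ j → IndexA₂ j → Description
  descA₂ k1 j (inj₂ zero , k2) = desc (into₁ k1) anyParents (prof₂ j k2) anyParents false
  descA₂ k1 j (inj₂ (suc _) , k2) = desc (into₁ k1) anyParents (prof₂ j k2) noParents true
  descA₂ k1 j (inj₁ t , k2) = desc (into₁ k1) anyParents (prof₂ j k2) (onlyParent (nbr₂ j k2 t)) true
  descA₃ : ∀ i → IndexA₃ i → Description
  descA₃ i (k1 , inj₁ (inj₂ _ , k2)) = desc (prof₁ i k1) noParents (into₂ k2) anyParents false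
  descA₃ i (k1 , inj₁ (inj₁ t , k2)) = desc (prof₁ i k1) (onlyParent (nbr₁ i k1 t)) (into₂ k2) anyParents false
  descA₃ i (k1 , inj₂ (t , k2)) = desc (prof₁ i k1) (onlyParent (nbr₁ i k1 t)) (free₂ k2) anyParents false

  RealisesA₂ : Fin a₁ → ∀ j → IndexA₂ j → DAG G → Set₁
  RealisesA₂ k1 j x D = RealisesD (descA₂ k1 j x) D
  RealisesA₃ : ∀ i → IndexA₃ i → DAG G → Set₁
  RealisesA₃ i x D = RealisesD (descA₃ i x) D

  RealisesA : IndexA → DAG G → Set₁
  RealisesA (inj₁ (k1 , inj₁ (u , k2))) D = RealisesD (descA₁ k1 u k2) D
  RealisesA (inj₁ (k1 , inj₂ s)) D = SpecUpTo IndexA₂ (RealisesA₂ k1) δ₂ s D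
  RealisesA (inj₂ s) D = SpecUpTo IndexA₃ RealisesA₃ (δ ∸ 1) s D

  IndexA↔ : Fin (a₁ * (2 * a₂ + sumTo δ₂ (λ j → (j + 2) * b₂ j))
           + sumTo (δ ∸ 1) (λ i → b₁ i * ((i + 1) * a₂ + i * c₂))) ↔ IndexA
  IndexA↔ = ↔-trans +↔⊎
    (↔-trans (*↔× {a₁}) (↔-refl ×-↔ ↔-trans +↔⊎
       (*↔× {2} {a₂} ⊎-↔ Fin-sumTo↔SumUpTo δ₂ _ IndexA₂ (λ j → ↔-trans (*↔× {j + 2} {b₂ j}) (+↔⊎ {j} {2} ×-↔ ↔-refl))))
     ⊎-↔ Fin-sumTo↔SumUpTo (δ ∸ 1) _ IndexA₃ (λ i → ↔-trans (*↔× {b₁ i}) (↔-refl ×-↔ ↔-trans +↔⊎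
       (↔-trans (*↔× {i + 1} {a₂}) (+↔⊎ {i} {1} ×-↔ ↔-refl) ⊎-↔ *↔× {i} {c₂}))))

  CountedA : DAG G → Set₁
  CountedA D = IntoR G r₁ D

  into₁⇒intoR : ∀ k1 (D : DAG G) → MarkovEq G₁ (into₁ k1) (restrict₁ D) → ¬ ¬ (CountedA D)
  into₁⇒intoR k1 D m1 = intoR₁⇒intoR D (OnG₁.intoR-markov (into₁ k1) (restrict₁ D) m1 (into₁-intoR k1))

  existsA₂ : ∀ k1 j x → ¬ ¬ (Σ (DAG G) λ D → RealisesA₂ k1 j x D × CountedA D)
  existsA₂ k1 j (inj₂ zero , k2) = let (D , s) = realise (descA₂ k1 j (inj₂ zero , k2)) ((λ _ _ → into₁-intoR k1) , (λ ())) (member₁-any (into₁ k1)) (member₂-any (class₂ (descA₂ k1 j (inj₂ zero , k2))))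
    in into₁⇒intoR k1 D (Realises.markov₁ (proj₂ s)) >>= λ p → return (D , s , p)
  existsA₂ k1 j (inj₂ (suc zero) , k2) = member₂-none (prof₂ j k2) (prof₂-¬intoR j k2) >>= λ M →
    let (D , s) = realise (descA₂ k1 j (inj₂ (suc zero) , k2)) ((λ _ _ → into₁-intoR k1) , (λ _ ())) (member₁-any (into₁ k1)) M
    in into₁⇒intoR k1 D (Realises.markov₁ (proj₂ s)) >>= λ p → return (D , s , p)
  existsA₂ k1 j (inj₁ t , k2) = member₂-only (prof₂ j k2) (prof₂-¬intoR j k2) (nbr₂-undirected j k2 t) >>= λ M →
    let (D , s) = realise (descA₂ k1 j (inj₁ t , k2)) ((λ _ _ → into₁-intoR k1) , (λ _ ())) (member₁-any (into₁ k1)) M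
    in into₁⇒intoR k1 D (Realises.markov₁ (proj₂ s)) >>= λ p → return (D , s , p)

  existsA₃ : ∀ i x → ¬ ¬ (Σ (DAG G) λ D → RealisesA₃ i x D × CountedA D)
  existsA₃ i (k1 , inj₁ (inj₂ zero , k2)) = member₁-none (prof₁ i k1) (prof₁-¬intoR i k1) >>= λ M →
    let (D , s) = realise (descA₃ i (k1 , inj₁ (inj₂ zero , k2))) ((λ _ ()) , (λ ())) M (member₂-any (into₂ k2))
        realises _ _ m2 _ d = proj₂ s
    in intoR₂⇒intoR D d (OnG₂.intoR-markov (into₂ k2) (restrict₂ D) m2 (into₂-intoR k2)) >>= λ p → return (D , s , p)
  existsA₃ i (k1 , inj₁ (inj₁ t , k2)) = member₁-only (prof₁ i k1) (prof₁-¬intoR i k1) (nbr₁-undirected i k1 t) >>= λ M →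
    let (D , s) = realise (descA₃ i (k1 , inj₁ (inj₁ t , k2))) ((λ _ ()) , (λ ())) M (member₂-any (into₂ k2))
        realises _ (yr , _) _ _ d = proj₂ s
    in return (D , s , parent₁⇒intoR D d yr)
  existsA₃ i (k1 , inj₂ (t , k2)) = member₁-only (prof₁ i k1) (prof₁-¬intoR i k1) (nbr₁-undirected i k1 t) >>= λ M →
    let (D , s) = realise (descA₃ i (k1 , inj₂ (t , k2))) ((λ _ ()) , (λ ())) M (member₂-any (free₂ k2))
        realises _ (yr , _) _ _ d = proj₂ s
    in return (D , s , parent₁⇒intoR D d yr)

  existsA : ∀ c → ¬ ¬ (Σ (DAG G) λ D → RealisesA c D × CountedA D)
  existsA (inj₁ (k1 , inj₁ (u , k2))) = let (D , s) = realise (descA₁ k1 u k2) ((λ _ _ → into₁-intoR k1) , (λ _ _ → into₂-intoR k2)) (member₁-any (into₁ k1)) (member₂-any (into₂ k2))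
    in into₁⇒intoR k1 D (Realises.markov₁ (proj₂ s)) >>= λ p → return (D , s , p)
  existsA (inj₁ (k1 , inj₂ s)) = specUpTo-exists IndexA₂ (RealisesA₂ k1) (existsA₂ k1) δ₂ s
  existsA (inj₂ s) = specUpTo-exists IndexA₃ RealisesA₃ existsA₃ (δ ∸ 1) s

  markov₁-between : ∀ b b' (D D' : DAG G) → MarkovEq G₁ b (restrict₁ D) → MarkovEq G₁ b' (restrict₁ D') → MarkovEq G D D' →
    MarkovEq G₁ b b'
  markov₁-between b b' D D' m m' e = OnG₁.markov-trans b (restrict₁ D) b' m
    (OnG₁.markov-trans (restrict₁ D) (restrict₁ D') b' (proj₁ (markov⇒parts D D' e)) (OnG₁.markov-sym b' (restrict₁ D') m'))
  markov₂-between : ∀ b b' (D D' : DAG G) → MarkovEq G₂ b (restrict₂ D) → MarkovEq G₂ b' (restrict₂ D') → MarkovEq G D D' →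
    MarkovEq G₂ b b'
  markov₂-between b b' D D' m m' e = OnG₂.markov-trans b (restrict₂ D) b' m
    (OnG₂.markov-trans (restrict₂ D) (restrict₂ D') b' (proj₁ (proj₂ (markov⇒parts D D' e)))
          (OnG₂.markov-sym b' (restrict₂ D') m'))

  markovA₂ : ∀ k1 j x (D : DAG G) → RealisesA₂ k1 j x D →
    MarkovEq G₁ (into₁ k1) (restrict₁ D) × MarkovEq G₂ (prof₂ j (proj₂ x)) (restrict₂ D)
  markovA₂ k1 j (inj₂ zero , k2) D (_ , realises m1 _ m2 _ _) = m1 , m2
  markovA₂ k1 j (inj₂ (suc zero) , k2) D (_ , realises m1 _ m2 _ _) = m1 , m2
  markovA₂ k1 j (inj₁ t , k2) D (_ , realises m1 _ m2 _ _) = m1 , m2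

  markovA₃ : ∀ i x (D : DAG G) → RealisesA₃ i x D → MarkovEq G₁ (prof₁ i (proj₁ x)) (restrict₁ D)
  markovA₃ i (k1 , inj₁ (inj₂ zero , k2)) D (_ , realises m1 _ _ _ _) = m1
  markovA₃ i (k1 , inj₁ (inj₁ t , k2)) D (_ , realises m1 _ _ _ _) = m1
  markovA₃ i (k1 , inj₂ (t , k2)) D (_ , realises m1 _ _ _ _) = m1

  markovA₃-into₂ : ∀ i k1 w k2 (D : DAG G) → RealisesA₃ i (k1 , inj₁ (w , k2)) D → MarkovEq G₂ (into₂ k2) (restrict₂ D)
  markovA₃-into₂ i k1 (inj₂ zero) k2 D (_ , realises _ _ m2 _ _) = m2
  markovA₃-into₂ i k1 (inj₁ t) k2 D (_ , realises _ _ m2 _ _) = m2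

  markovA₁ : ∀ k1 X (D : DAG G) → RealisesA (inj₁ (k1 , X)) D → MarkovEq G₁ (into₁ k1) (restrict₁ D)
  markovA₁ k1 (inj₁ (u , k2)) D (_ , realises m1 _ _ _ _) = m1
  markovA₁ k1 (inj₂ s) D h with specUpTo-index IndexA₂ (RealisesA₂ k1) δ₂ s D h
  ... | j , _ , x , h' = proj₁ (markovA₂ k1 j x D h')

  markovA-prof₁ : ∀ s (D : DAG G) → RealisesA (inj₂ s) D → Σ ℕ λ i → Σ (Fin (b₁ i)) λ k →
    MarkovEq G₁ (prof₁ i k) (restrict₁ D)
  markovA-prof₁ s D h with specUpTo-index IndexA₃ RealisesA₃ (δ ∸ 1) s D h
  ... | i , _ , x , h' = i , proj₁ x , markovA₃ i x D h'

  indexA₂-unique : ∀ k1 j j' x x' (D D' : DAG G) → RealisesA₂ k1 j x D → RealisesA₂ k1 j' x' D' → MarkovEq G D D' → j ≡ j'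
  indexA₂-unique k1 j j' x x' D D' h h' e = prof₂-index-unique
      (markov₂-between (prof₂ j (proj₂ x)) (prof₂ j' (proj₂ x')) D D' (proj₂ (markovA₂ k1 j x D h))
            (proj₂ (markovA₂ k1 j' x' D' h')) e)

  termA₂-unique : ∀ k1 j x x' (D D' : DAG G) → RealisesA₂ k1 j x D → RealisesA₂ k1 j x' D' → MarkovEq G D D' → x ≡ x'
  termA₂-unique k1 j x@(w , k2) x'@(w' , k2') D D' h h' e
    with prof₂-injective j k2 k2' (markov₂-between (prof₂ j k2) (prof₂ j k2') D D' (proj₂ (markovA₂ k1 j x D h))
          (proj₂ (markovA₂ k1 j x' D' h')) e)
  ... | refl = cong (λ z → z , k2) (f w w' h h')
    where
    f : ∀ w w' → RealisesA₂ k1 j (w , k2) D → RealisesA₂ k1 j (w' , k2) D' → w ≡ w'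
    f (inj₂ zero) (inj₂ zero) _ _ = refl
    f (inj₂ (suc zero)) (inj₂ (suc zero)) _ _ = refl
    f (inj₂ zero) (inj₂ (suc zero)) (_ , s) (_ , s') with bridgeV₁-any D s (into₁-intoR k1)
    ... | x , b = ⊥-elim (bridgeV₁-absent D' s' x (to (e r₂ r₁ x) b))
    f (inj₂ zero) (inj₁ t) (_ , s) (_ , s') with bridgeV₁-any D s (into₁-intoR k1)
    ... | x , b = ⊥-elim (bridgeV₁-absent D' s' x (to (e r₂ r₁ x) b))
    f (inj₂ (suc zero)) (inj₂ zero) (_ , s) (_ , s') with bridgeV₁-any D' s' (into₁-intoR k1)
    ... | x , b = ⊥-elim (bridgeV₁-absent D s x (from (e r₂ r₁ x) b))
    f (inj₁ t) (inj₂ zero) (_ , s) (_ , s') with bridgeV₁-any D' s' (into₁-intoR k1)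
    ... | x , b = ⊥-elim (bridgeV₁-absent D s x (from (e r₂ r₁ x) b))
    f (inj₂ (suc zero)) (inj₁ t) (_ , s) (_ , s') = ⊥-elim
        (bridgeV₂-none D s _ (from (e r₁ r₂ _) (bridgeV₂-onlyParent D' s')))
    f (inj₁ t) (inj₂ (suc zero)) (_ , s) (_ , s') = ⊥-elim (bridgeV₂-none D' s' _ (to (e r₁ r₂ _) (bridgeV₂-onlyParent D s)))
    f (inj₁ t) (inj₁ t') (_ , s) (_ , s') = cong inj₁
        (nbr₂-injective j k2 t t' (bridgeV₂-only D' s' _ (to (e r₁ r₂ _) (bridgeV₂-onlyParent D s))))
    f (inj₂ (suc (suc ()))) _ _ _
    f _ (inj₂ (suc (suc ()))) _ _

  indexA₃-unique : ∀ i i' x x' (D D' : DAG G) → RealisesA₃ i x D → RealisesA₃ i' x' D' → MarkovEq G D D' → i ≡ i'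
  indexA₃-unique i i' x x' D D' h h' e = prof₁-index-unique
      (markov₁-between (prof₁ i (proj₁ x)) (prof₁ i' (proj₁ x')) D D' (markovA₃ i x D h) (markovA₃ i' x' D' h') e)

  termA₃-unique : ∀ i x x' (D D' : DAG G) → RealisesA₃ i x D → RealisesA₃ i x' D' → MarkovEq G D D' → x ≡ x'
  termA₃-unique i x@(k1 , Y) x'@(k1' , Y') D D' h h' e with prof₁-injective i k1 k1'
      (markov₁-between (prof₁ i k1) (prof₁ i k1') D D' (markovA₃ i x D h) (markovA₃ i x' D' h') e)
  ... | refl = cong (λ z → k1 , z) (f Y Y' h h')
    where
    f : ∀ Y Y' → RealisesA₃ i (k1 , Y) D → RealisesA₃ i (k1 , Y') D' → Y ≡ Y'
    f (inj₁ (w , k2)) (inj₁ (w' , k2')) h h' with into₂-injective k2 k2'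
        (markov₂-between (into₂ k2) (into₂ k2') D D' (markovA₃-into₂ i k1 w k2 D h) (markovA₃-into₂ i k1 w' k2' D' h') e)
    ... | refl = cong (λ z → inj₁ (z , k2)) (g w w' h h')
      where
      g : ∀ w w' → RealisesA₃ i (k1 , inj₁ (w , k2)) D → RealisesA₃ i (k1 , inj₁ (w' , k2)) D' → w ≡ w'
      g (inj₂ zero) (inj₂ zero) h h' = refl
      g (inj₂ zero) (inj₁ t) (_ , s) (_ , s') = ⊥-elim (bridgeV₁-none D s _ (from (e r₂ r₁ _) (bridgeV₁-onlyParent D' s')))
      g (inj₁ t) (inj₂ zero) (_ , s) (_ , s') = ⊥-elim (bridgeV₁-none D' s' _ (to (e r₂ r₁ _) (bridgeV₁-onlyParent D s)))
      g (inj₁ t) (inj₁ t') (_ , s) (_ , s') =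
        cong inj₁ (nbr₁-injective i k1 t t' (bridgeV₁-only D' s' _ (to (e r₂ r₁ _) (bridgeV₁-onlyParent D s))))
      g (inj₂ (suc ())) _ _ _
      g _ (inj₂ (suc ())) _ _
    f (inj₁ (w , k2)) (inj₂ (t' , k2')) h (_ , realises _ _ m2' _ _) = ⊥-elim
        (into₂≉free₂ (markov₂-between (into₂ k2) (free₂ k2') D D' (markovA₃-into₂ i k1 w k2 D h) m2' e))
    f (inj₂ (t , k2)) (inj₁ (w' , k2')) (_ , realises _ _ m2 _ _) h' =
      ⊥-elim (into₂≉free₂ (markov₂-between (into₂ k2') (free₂ k2) D' D (markovA₃-into₂ i k1 w' k2' D' h') m2
            (OnG.markov-sym D D' e)))
    f (inj₂ (t , k2)) (inj₂ (t' , k2')) (_ , s@(realises _ _ m2 _ _)) (_ , s'@(realises _ _ m2' _ _))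
      with free₂-injective k2 k2' (markov₂-between (free₂ k2) (free₂ k2') D D' m2 m2' e)
    ... | refl = cong (λ z → inj₂ (z , k2)) (nbr₁-injective i k1 t t'
          (bridgeV₁-only D' s' _ (to (e r₂ r₁ _) (bridgeV₁-onlyParent D s))))

  injectiveA₁ : ∀ k1 X X' (D D' : DAG G) → RealisesA (inj₁ (k1 , X)) D → RealisesA (inj₁ (k1 , X')) D' → MarkovEq G D D' →
    X ≡ X'
  injectiveA₁ k1 (inj₁ (u , k2)) (inj₁ (u' , k2')) D D' (_ , s@(realises _ _ m2 _ _)) (_ , s'@(realises _ _ m2' _ _)) e
    with into₂-injective k2 k2' (markov₂-between (into₂ k2) (into₂ k2') D D' m2 m2' e)
  ... | refl = cong (λ z → inj₁ (z , k2)) (f u u' s s')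
    where
    f : ∀ u u' → Realises (into₁ k1) anyParents (into₂ k2) anyParents (orientation-bit u) D →
      Realises (into₁ k1) anyParents (into₂ k2) anyParents (orientation-bit u') D' → u ≡ u'
    f zero zero _ _ = refl
    f (suc zero) (suc zero) _ _ = refl
    f zero (suc zero) s s' with bridgeV₁-any D s (into₁-intoR k1)
    ... | x , b = ⊥-elim (bridgeV₁-absent D' s' x (to (e r₂ r₁ x) b))
    f (suc zero) zero s s' with bridgeV₁-any D' s' (into₁-intoR k1)
    ... | x , b = ⊥-elim (bridgeV₁-absent D s x (from (e r₂ r₁ x) b))
    f (suc (suc ())) _ _ _
    f _ (suc (suc ())) _ _
  injectiveA₁ k1 (inj₁ (u , k2)) (inj₂ s') D D' (_ , realises _ _ m2 _ _) h' e with specUpTo-index IndexA₂ (RealisesA₂ k1)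
      δ₂ s' D' h'
  ... | j , _ , x , h'' = ⊥-elim (into₂≉prof₂
        (markov₂-between (into₂ k2) (prof₂ j (proj₂ x)) D D' m2 (proj₂ (markovA₂ k1 j x D' h'')) e))
  injectiveA₁ k1 (inj₂ s) (inj₁ (u , k2)) D D' h (_ , realises _ _ m2 _ _) e with specUpTo-index IndexA₂ (RealisesA₂ k1) δ₂
      s D h
  ... | j , _ , x , h'' = ⊥-elim (into₂≉prof₂
        (markov₂-between (into₂ k2) (prof₂ j (proj₂ x)) D' D m2 (proj₂ (markovA₂ k1 j x D h'')) (OnG.markov-sym D D' e)))
  injectiveA₁ k1 (inj₂ s) (inj₂ s') D D' h h' e =
    cong inj₂ (specUpTo-injective IndexA₂ (RealisesA₂ k1) (indexA₂-unique k1) (termA₂-unique k1) δ₂ s s' D D' h h' e)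

  injectiveA : ∀ c c' (D D' : DAG G) → RealisesA c D → RealisesA c' D' → MarkovEq G D D' → c ≡ c'
  injectiveA (inj₁ (k1 , X)) (inj₁ (k1' , X')) D D' h h' e with into₁-injective k1 k1'
      (markov₁-between (into₁ k1) (into₁ k1') D D' (markovA₁ k1 X D h) (markovA₁ k1' X' D' h') e)
  ... | refl = cong (λ z → inj₁ (k1 , z)) (injectiveA₁ k1 X X' D D' h h' e)
  injectiveA (inj₁ (k1 , X)) (inj₂ s') D D' h h' e with markovA-prof₁ s' D' h'
  ... | i , k , m' = ⊥-elim (into₁≉prof₁ (markov₁-between (into₁ k1) (prof₁ i k) D D' (markovA₁ k1 X D h) m' e))
  injectiveA (inj₂ s) (inj₁ (k1 , X)) D D' h h' e with markovA-prof₁ s D h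
  ... | i , k , m = ⊥-elim (into₁≉prof₁ (markov₁-between (into₁ k1) (prof₁ i k) D' D (markovA₁ k1 X D' h') m
        (OnG.markov-sym D D' e)))
  injectiveA (inj₂ s) (inj₂ s') D D' h h' e = cong inj₂
      (specUpTo-injective IndexA₃ RealisesA₃ indexA₃-unique termA₃-unique (δ ∸ 1) s s' D D' h h' e)

  into₁-cover : ∀ D₁ → IntoR G₁ r₁ D₁ → Σ (Fin a₁) λ k → MarkovEq G₁ (into₁ k) D₁
  into₁-cover D₁ p with proj₂ (proj₂ (proj₂ sysA₁)) D₁ p
  ... | k , m = k , OnG₁.markov-sym D₁ (into₁ k) m
  prof₁-cover : ∀ i D₁ → ProfileAt G₁ r₁ i D₁ → Σ (Fin (b₁ i)) λ k → MarkovEq G₁ (prof₁ i k) D₁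
  prof₁-cover i D₁ p with proj₂ (proj₂ (proj₂ (sysB₁ i))) D₁ p
  ... | k , m = k , OnG₁.markov-sym D₁ (prof₁ i k) m
  into₂-cover : ∀ D₂ → IntoR G₂ r₂ D₂ → Σ (Fin a₂) λ k → MarkovEq G₂ (into₂ k) D₂
  into₂-cover D₂ p with proj₂ (proj₂ (proj₂ sysA₂)) D₂ p
  ... | k , m = k , OnG₂.markov-sym D₂ (into₂ k) m
  free₂-cover : ∀ D₂ → ¬ IntoR G₂ r₂ D₂ → Σ (Fin c₂) λ k → MarkovEq G₂ (free₂ k) D₂
  free₂-cover D₂ p with proj₂ (proj₂ (proj₂ sysC₂)) D₂ p
  ... | k , m = k , OnG₂.markov-sym D₂ (free₂ k) m
  prof₂-cover : ∀ j D₂ → ProfileAt G₂ r₂ j D₂ → Σ (Fin (b₂ j)) λ k → MarkovEq G₂ (prof₂ j k) D₂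
  prof₂-cover j D₂ p with proj₂ (proj₂ (proj₂ (sysB₂ j))) D₂ p
  ... | k , m = k , OnG₂.markov-sym D₂ (prof₂ j k) m

  coverA₂ : ∀ k1 (D : DAG G) → MarkovEq G₁ (into₁ k1) (restrict₁ D) → ¬ IntoR G₂ r₂ (restrict₂ D) →
    ¬ ¬ (Σ ℕ λ j → j ≤ δ₂ × Σ (IndexA₂ j) λ x → RealisesA₂ k1 j x D)
  coverA₂ k1 D m1 n2 = OnG₂.profile-exists (restrict₂ D) n2 >>= λ { (j , prof) →
    let (k2 , m2) = prof₂-cover j (restrict₂ D) prof
        bnd = profile₂-bound (restrict₂ D) prof
    in case (OnG.orient D bridge) j k2 m2 bnd }
    where
    case : OnG.Arc D r₁ r₂ ⊎ OnG.Arc D r₂ r₁ → ∀ j k2 → MarkovEq G₂ (prof₂ j k2) (restrict₂ D) → j ≤ δ₂ →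
      ¬ ¬ (Σ ℕ λ j → j ≤ δ₂ × Σ (IndexA₂ j) λ x → RealisesA₂ k1 j x D)
    case (inj₂ d) j k2 m2 bnd = return (j , bnd , (inj₂ zero , k2) , ((λ _ _ → into₁-intoR k1) , (λ ())) , realises m1 tt m2
          tt d)
    case (inj₁ d) j k2 m2 bnd = ¬¬-⊎¬ (Σ (Fin n) λ y → Arc₂ (restrict₂ D) y r₂) >>= λ
      { (inj₂ np) → return (j , bnd , (inj₂ (suc zero) , k2) , ((λ _ _ → into₁-intoR k1) , (λ _ ())) ,
                         realises m1 tt m2 (λ a ar → np (a , ar)) d)
      ; (inj₁ (y , yr)) → parent-index₂ D j k2 m2 n2 yr >>= λ { (t , q) →
          return (j , bnd , (inj₁ t , k2) , ((λ _ _ → into₁-intoR k1) , (λ _ ())) , realises m1 tt m2 q d) } }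

  coverA₃ : ∀ (D : DAG G) → IntoR G r₁ D → ¬ IntoR G₁ r₁ (restrict₁ D) →
    ¬ ¬ (Σ ℕ λ i → i ≤ δ ∸ 1 × Σ (IndexA₃ i) λ x → RealisesA₃ i x D)
  coverA₃ D ii n1 = OnG₁.profile-exists (restrict₁ D) n1 >>= λ { (i , prof) →
    let (k1 , m1) = prof₁-cover i (restrict₁ D) prof
        bnd = profile₁-bound (restrict₁ D) prof
    in case (OnG.orient D bridge) i k1 m1 bnd }
    where
    case : OnG.Arc D r₁ r₂ ⊎ OnG.Arc D r₂ r₁ → ∀ i k1 → MarkovEq G₁ (prof₁ i k1) (restrict₁ D) → i ≤ δ ∸ 1 →
      ¬ ¬ (Σ ℕ λ i → i ≤ δ ∸ 1 × Σ (IndexA₃ i) λ x → RealisesA₃ i x D)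
    case (inj₁ d) i k1 m1 bnd = ⊥-elim (out-¬intoR₁⇒¬intoR D d n1 ii)
    case (inj₂ d) i k1 m1 bnd = ¬¬-⊎¬ (Σ (Fin n) λ x → Arc₁ (restrict₁ D) x r₁) >>= λ
      { (inj₂ np) → ¬¬-⊎¬ (IntoR G₂ r₂ (restrict₂ D)) >>= λ
          { (inj₂ n2) → ⊥-elim (in-¬intoR₂⇒¬intoR D d n2 (λ a ar → np (a , ar)) ii)
          ; (inj₁ y2) → let (k2 , m2) = into₂-cover (restrict₂ D) y2 in
              return (i , bnd , (k1 , inj₁ (inj₂ zero , k2)) , ((λ _ ()) , (λ ())) , realises m1 (λ a ar → np (a , ar)) m2
                    tt d) }
      ; (inj₁ (x , xr)) → parent-index₁ D i k1 m1 n1 xr >>= λ { (t , q) → ¬¬-⊎¬ (IntoR G₂ r₂ (restrict₂ D)) >>= λ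
          { (inj₁ y2) → let (k2 , m2) = into₂-cover (restrict₂ D) y2 in
              return (i , bnd , (k1 , inj₁ (inj₁ t , k2)) , ((λ _ ()) , (λ ())) , realises m1 q m2 tt d)
          ; (inj₂ n2) → let (k2 , m2) = free₂-cover (restrict₂ D) n2 in
              return (i , bnd , (k1 , inj₂ (t , k2)) , ((λ _ ()) , (λ ())) , realises m1 q m2 tt d) } } }

  coverA : ∀ (D : DAG G) → CountedA D → ¬ ¬ (Σ IndexA λ c → RealisesA c D)
  coverA D ii = ¬¬-⊎¬ (IntoR G₁ r₁ (restrict₁ D)) >>= λ
    { (inj₁ y1) → let (k1 , m1) = into₁-cover (restrict₁ D) y1 in ¬¬-⊎¬ (IntoR G₂ r₂ (restrict₂ D)) >>= λ
        { (inj₁ y2) → let (k2 , m2) = into₂-cover (restrict₂ D) y2 in return (top k1 k2 m1 m2 (OnG.orient D bridge))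
        ; (inj₂ n2) → coverA₂ k1 D m1 n2 >>= λ { (j , bnd , x , h) →
            let (s , h') = specUpTo-intro IndexA₂ (RealisesA₂ k1) δ₂ j bnd x D h in return (inj₁ (k1 , inj₂ s) , h') } }
    ; (inj₂ n1) → coverA₃ D ii n1 >>= λ { (i , bnd , x , h) →
        let (s , h') = specUpTo-intro IndexA₃ RealisesA₃ (δ ∸ 1) i bnd x D h in return (inj₂ s , h') } }
    where
    top : ∀ k1 k2 → MarkovEq G₁ (into₁ k1) (restrict₁ D) → MarkovEq G₂ (into₂ k2) (restrict₂ D) →
      OnG.Arc D r₁ r₂ ⊎ OnG.Arc D r₂ r₁ →
      Σ IndexA λ c → RealisesA c D
    top k1 k2 m1 m2 (inj₁ d) = inj₁ (k1 , inj₁ (suc zero , k2)) , ((λ _ _ → into₁-intoR k1) , (λ _ _ → into₂-intoR k2)) ,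
        realises m1 tt m2 tt d
    top k1 k2 m1 m2 (inj₂ d) = inj₁ (k1 , inj₁ (zero , k2)) , ((λ _ _ → into₁-intoR k1) , (λ _ _ → into₂-intoR k2)) ,
        realises m1 tt m2 tt d

  realisesA-markov : ∀ c (D D' : DAG G) → RealisesA c D → RealisesA c D' → ¬ ¬ (MarkovEq G D D')
  realisesA-markov (inj₁ (k1 , inj₁ (u , k2))) D D' h h' = realisesD-markov (descA₁ k1 u k2) D D' h h'
  realisesA-markov (inj₁ (k1 , inj₂ s)) D D' h h' = specUpTo-markov IndexA₂ (RealisesA₂ k1)
      (λ j x → realisesD-markov (descA₂ k1 j x)) δ₂ s D D' h h'
  realisesA-markov (inj₂ s) D D' h h' = specUpTo-markov IndexA₃ RealisesA₃ (λ i x → realisesD-markov (descA₃ i x)) (δ ∸ 1) s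
      D D' h h'

  module Classes (P : DAG G → Set₁) = ClassCounting (MarkovEq G) (λ {a} {b} → OnG.markov-sym a b)
      (λ {a} {b} {c} → OnG.markov-trans a b c) P

  formulaA : ∀ (A : ℕ) → N1 G r₁ A →
    ¬ ¬ (A ≡ a₁ * (2 * a₂ + sumTo δ₂ (λ j → (j + 2) * b₂ j))
           + sumTo (δ ∸ 1) (λ i → b₁ i * ((i + 1) * a₂ + i * c₂)))
  formulaA A sys = ¬¬-Π-↔ IndexA↔ existsA >>= λ tab →
    Classes.countClasses-unique CountedA A sys IndexA _ IndexA↔ (λ c → proj₁ (tab c)) (λ c → proj₂ (proj₂ (tab c)))
      (λ c c' e → injectiveA c c' _ _ (proj₁ (proj₂ (tab c))) (proj₁ (proj₂ (tab c'))) e)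
      (λ D p → coverA D p >>= λ { (c , h) → realisesA-markov c D (proj₁ (tab c)) h (proj₁ (proj₂ (tab c))) >>= λ e → return
            (c , e) })

  -- Formulas (2) and (3): now r₁ → r₂, and r₂ becomes an extra undirected neighbour of r₁ exactly
  -- when r₂ has no parent on its own side (the summand IndexB-bridge).
  CountedB : ℕ → DAG G → Set₁
  CountedB i D = ProfileAt G r₁ i D

  Undirected₁ : DAG G → Fin n → Set₁
  Undirected₁ D x = Undirected G₁ (restrict₁ D) r₁ x
  UndirectedG : DAG G → Fin n → Set₁
  UndirectedG D x = Undirected G D r₁ x

  undirected-relate : ∀ (D : DAG G) → Oriented true D → Σ (Fin n) (λ y → Arc₂ (restrict₂ D) y r₂) →
    ¬ ¬ (∀ x → (Undirected₁ D x → UndirectedG D x) × (UndirectedG D x → Undirected₁ D x))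
  undirected-relate D d (y , yr) = ¬¬-Π-Fin n λ x →
    ¬¬-→ (undirected₁⇒undirected D d x) >>= λ f → ¬¬-→ (g x) >>= λ g' → return (f , g')
    where
    g : ∀ x → UndirectedG D x → ¬ ¬ (Undirected₁ D x)
    g x u with x ≟ r₂
    ... | yes refl = ⊥-elim (¬undirected-bridge D d yr u)
    ... | no ne = undirected⇒undirected₁ D d x ne u

  undirected-relate-bridge : ∀ (D : DAG G) → Oriented true D → (∀ a → ¬ Arc₂ (restrict₂ D) a r₂) → ¬ IntoR G r₁ D →
    ¬ ¬ (∀ x → (Undirected₁ D x ⊎ x ≡ r₂ → UndirectedG D x) × (UndirectedG D x → Undirected₁ D x ⊎ x ≡ r₂))
  undirected-relate-bridge D d np ni = ¬¬-Π-Fin n λ x → ¬¬-→ (f x) >>= λ f' → ¬¬-→ (g x) >>= λ g' → return (f' , g')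
    where
    f : ∀ x → Undirected₁ D x ⊎ x ≡ r₂ → ¬ ¬ (UndirectedG D x)
    f x (inj₁ u) = undirected₁⇒undirected D d x u
    f x (inj₂ refl) = undirected-bridge D d np ni
    g : ∀ x → UndirectedG D x → ¬ ¬ (Undirected₁ D x ⊎ x ≡ r₂)
    g x u with x ≟ r₂
    ... | yes e = return (inj₂ e)
    ... | no ne = undirected⇒undirected₁ D d x ne u >>= λ u' → return (inj₁ u')

  realises⇒¬intoR : ∀ i k1 {p1 b2 p2} (D : DAG G) → Realises (prof₁ i k1) p1 b2 p2 true D → ¬ IntoR G r₁ D
  realises⇒¬intoR i k1 D (realises m1 _ _ _ d) = out-¬intoR₁⇒¬intoR D d
      (λ ii → prof₁-¬intoR i k1 (OnG₁.intoR-markov (restrict₁ D) (prof₁ i k1)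
            (OnG₁.markov-sym (prof₁ i k1) (restrict₁ D) m1) ii))

  profileB : ∀ i k1 {b2 p2} (D : DAG G) → Realises (prof₁ i k1) anyParents b2 p2 true D →
    Σ (Fin n) (λ y → Arc₂ (restrict₂ D) y r₂) →
    ¬ ¬ (CountedB i D)
  profileB i k1 {b2} {p2} D s@(realises m1 _ _ _ d) yy =
    ¬¬-Π-Fin n (OnG.edge-classified D ni) >>= λ ed → undirected-relate D d yy >>= λ rel →
    return (ni , ed , countFin-cong (prof₁-count i k1)
      (λ x u → proj₁ (rel x) (OnG₁.undirected-markov (prof₁ i k1) (restrict₁ D) m1 u))
      (λ x u → OnG₁.undirected-markov (restrict₁ D) (prof₁ i k1) (OnG₁.markov-sym (prof₁ i k1) (restrict₁ D) m1)
            (proj₂ (rel x) u)))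
    where
    ni : ¬ IntoR G r₁ D
    ni = realises⇒¬intoR i k1 {anyParents} {b2} {p2} D s

  profileB-bridge : ∀ i k1 {b2} (D : DAG G) → Realises (prof₁ i k1) anyParents b2 noParents true D → ¬ ¬ (CountedB (suc i) D)
  profileB-bridge i k1 {b2} D s@(realises m1 _ _ np d) =
    ¬¬-Π-Fin n (OnG.edge-classified D ni) >>= λ ed → undirected-relate-bridge D d np ni >>= λ rel →
    return (ni , ed , countFin-cong (countFin-insert (prof₁-count i k1) (r₂-not-undirected₁ (prof₁ i k1)))
      (λ x u → proj₁ (rel x) (Sum.map (OnG₁.undirected-markov (prof₁ i k1) (restrict₁ D) m1) id u))
      (λ x u → Sum.map (OnG₁.undirected-markov (restrict₁ D) (prof₁ i k1) (OnG₁.markov-sym (prof₁ i k1) (restrict₁ D) m1)) id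
            (proj₂ (rel x) u)))
    where
    ni : ¬ IntoR G r₁ D
    ni = realises⇒¬intoR i k1 {anyParents} {b2} {noParents} D s

  IndexB₂ : ℕ → Set
  IndexB₂ j = Fin j × Fin (b₂ j)
  IndexB : ℕ → Set
  IndexB i = Fin (b₁ i) × (Fin a₂ ⊎ SumUpTo δ₂ IndexB₂)
  IndexB-bridge : ℕ → Set
  IndexB-bridge i' = Fin (b₁ i') × Fin c₂

  descB₁ : ∀ i → Fin (b₁ i) → Fin a₂ → Description
  descB₁ i k1 k2 = desc (prof₁ i k1) anyParents (into₂ k2) anyParents true
  descBⱼ : ∀ i → Fin (b₁ i) → ∀ j → IndexB₂ j → Description
  descBⱼ i k1 j (t , k2) = desc (prof₁ i k1) anyParents (prof₂ j k2) (onlyParent (nbr₂ j k2 t)) true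
  descB-bridge : ∀ i' → IndexB-bridge i' → Description
  descB-bridge i' (k1 , k2) = desc (prof₁ i' k1) anyParents (free₂ k2) noParents true

  RealisesBⱼ : ∀ i → Fin (b₁ i) → ∀ j → IndexB₂ j → DAG G → Set₁
  RealisesBⱼ i k1 j x D = RealisesD (descBⱼ i k1 j x) D

  RealisesB : ∀ i → IndexB i → DAG G → Set₁
  RealisesB i (k1 , inj₁ k2) D = RealisesD (descB₁ i k1 k2) D
  RealisesB i (k1 , inj₂ s) D = SpecUpTo IndexB₂ (RealisesBⱼ i k1) δ₂ s D

  existsB : ∀ i c → ¬ ¬ (Σ (DAG G) λ D → RealisesB i c D × CountedB i D)
  existsB i (k1 , inj₁ k2) =
    let (D , s) = realise (descB₁ i k1 k2) ((λ ()) , (λ _ _ → into₂-intoR k2)) (member₁-any (prof₁ i k1)) (member₂-any (into₂ k2))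
        realises m1 q1 m2 q2 d = proj₂ s
    in profileB i k1 D (proj₂ s) (intoR⇒parent₂ (restrict₂ D)
          (OnG₂.intoR-markov (into₂ k2) (restrict₂ D) m2 (into₂-intoR k2))) >>= λ p → return
        (D , s , p)
  existsB i (k1 , inj₂ s) = specUpTo-exists IndexB₂ (RealisesBⱼ i k1) f δ₂ s
    where
    f : ∀ j x → ¬ ¬ (Σ (DAG G) λ D → RealisesBⱼ i k1 j x D × CountedB i D)
    f j (t , k2) = member₂-only (prof₂ j k2) (prof₂-¬intoR j k2) (nbr₂-undirected j k2 t) >>= λ M →
      let (D , s) = realise (descBⱼ i k1 j (t , k2)) ((λ ()) , (λ _ ())) (member₁-any (prof₁ i k1)) M
          realises _ _ _ (yr , _) _ = proj₂ s
      in profileB i k1 D (proj₂ s) (_ , yr) >>= λ p → return (D , s , p)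

  existsB-bridge : ∀ i' c → ¬ ¬ (Σ (DAG G) λ D → RealisesD (descB-bridge i' c) D × CountedB (suc i') D)
  existsB-bridge i' (k1 , k2) = member₂-none (free₂ k2) (free₂-¬intoR k2) >>= λ M →
    let (D , s) = realise (descB-bridge i' (k1 , k2)) ((λ ()) , (λ _ ())) (member₁-any (prof₁ i' k1)) M
    in profileB-bridge i' k1 D (proj₂ s) >>= λ p → return (D , s , p)

  markovBⱼ : ∀ i k1 j x (D : DAG G) → RealisesBⱼ i k1 j x D →
    MarkovEq G₁ (prof₁ i k1) (restrict₁ D) × MarkovEq G₂ (prof₂ j (proj₂ x)) (restrict₂ D)
  markovBⱼ i k1 j (t , k2) D (_ , realises m1 _ m2 _ _) = m1 , m2

  markovB : ∀ i k1 Y (D : DAG G) → RealisesB i (k1 , Y) D → MarkovEq G₁ (prof₁ i k1) (restrict₁ D)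
  markovB i k1 (inj₁ k2) D (_ , realises m1 _ _ _ _) = m1
  markovB i k1 (inj₂ s) D h with specUpTo-index IndexB₂ (RealisesBⱼ i k1) δ₂ s D h
  ... | j , _ , x , h' = proj₁ (markovBⱼ i k1 j x D h')

  bridgeV₂-B : ∀ i c (D : DAG G) → RealisesB i c D → Σ (Fin n) λ y → BridgeV₂ D y
  bridgeV₂-B i (k1 , inj₁ k2) D (_ , s) = bridgeV₂-any D s (into₂-intoR k2)
  bridgeV₂-B i (k1 , inj₂ s) D h with specUpTo-index IndexB₂ (RealisesBⱼ i k1) δ₂ s D h
  ... | j , _ , (t , k2) , (_ , s') = _ , bridgeV₂-onlyParent D s'

  injectiveB : ∀ i c c' (D D' : DAG G) → RealisesB i c D → RealisesB i c' D' → MarkovEq G D D' → c ≡ c'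
  injectiveB i (k1 , Y) (k1' , Y') D D' h h' e with prof₁-injective i k1 k1'
      (markov₁-between (prof₁ i k1) (prof₁ i k1') D D' (markovB i k1 Y D h) (markovB i k1' Y' D' h') e)
  ... | refl = cong (λ z → k1 , z) (f Y Y' h h')
    where
    f : ∀ Y Y' → RealisesB i (k1 , Y) D → RealisesB i (k1 , Y') D' → Y ≡ Y'
    f (inj₁ k2) (inj₁ k2') (_ , realises _ _ m2 _ _) (_ , realises _ _ m2' _ _) = cong inj₁
        (into₂-injective k2 k2' (markov₂-between (into₂ k2) (into₂ k2') D D' m2 m2' e))
    f (inj₁ k2) (inj₂ s') (_ , realises _ _ m2 _ _) h' with specUpTo-index IndexB₂ (RealisesBⱼ i k1) δ₂ s' D' h'
    ... | j , _ , x , h'' = ⊥-elim (into₂≉prof₂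
          (markov₂-between (into₂ k2) (prof₂ j (proj₂ x)) D D' m2 (proj₂ (markovBⱼ i k1 j x D' h'')) e))
    f (inj₂ s) (inj₁ k2) h (_ , realises _ _ m2 _ _) with specUpTo-index IndexB₂ (RealisesBⱼ i k1) δ₂ s D h
    ... | j , _ , x , h'' = ⊥-elim (into₂≉prof₂
          (markov₂-between (into₂ k2) (prof₂ j (proj₂ x)) D' D m2 (proj₂ (markovBⱼ i k1 j x D h'')) (OnG.markov-sym D D' e)))
    f (inj₂ s) (inj₂ s') h h' = cong inj₂ (specUpTo-injective IndexB₂ (RealisesBⱼ i k1) jeq xeq δ₂ s s' D D' h h' e)
      where
      jeq : ∀ j j' x x' (D D' : DAG G) → RealisesBⱼ i k1 j x D → RealisesBⱼ i k1 j' x' D' → MarkovEq G D D' → j ≡ j'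
      jeq j j' x x' D D' h h' e = prof₂-index-unique
          (markov₂-between (prof₂ j (proj₂ x)) (prof₂ j' (proj₂ x')) D D' (proj₂ (markovBⱼ i k1 j x D h))
                (proj₂ (markovBⱼ i k1 j' x' D' h')) e)
      xeq : ∀ j x x' (D D' : DAG G) → RealisesBⱼ i k1 j x D → RealisesBⱼ i k1 j x' D' → MarkovEq G D D' → x ≡ x'
      xeq j (t , k2) (t' , k2') D D' h@(_ , s) h'@(_ , s') e
        with prof₂-injective j k2 k2' (markov₂-between (prof₂ j k2) (prof₂ j k2') D D' (proj₂ (markovBⱼ i k1 j (t , k2) D h))
              (proj₂ (markovBⱼ i k1 j (t' , k2') D' h')) e)
      ... | refl = cong (λ z → z , k2) (nbr₂-injective j k2 t t'
            (bridgeV₂-only D' s' _ (to (e r₁ r₂ _) (bridgeV₂-onlyParent D s))))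

  injectiveB-bridge : ∀ i' c c' (D D' : DAG G) → RealisesD (descB-bridge i' c) D → RealisesD (descB-bridge i' c') D' →
    MarkovEq G D D' → c ≡ c'
  injectiveB-bridge i' (k1 , k2) (k1' , k2') D D' (_ , realises m1 _ m2 _ _) (_ , realises m1' _ m2' _ _) e
    with prof₁-injective i' k1 k1' (markov₁-between (prof₁ i' k1) (prof₁ i' k1') D D' m1 m1' e) | free₂-injective k2 k2'
        (markov₂-between (free₂ k2) (free₂ k2') D D' m2 m2' e)
  ... | refl | refl = refl

  B≉B-bridge : ∀ i' c c' (D D' : DAG G) → RealisesB (suc i') c D → RealisesD (descB-bridge i' c') D' → MarkovEq G D D' → ⊥
  B≉B-bridge i' c (k1 , k2) D D' h (_ , s') e with bridgeV₂-B (suc i') c D h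
  ... | y , b = bridgeV₂-none D' s' y (to (e r₁ r₂ y) b)

  orient-out : ∀ (D : DAG G) → ¬ IntoR G r₁ D → ¬ ¬ (Σ (DAG G) λ D' → MarkovEq G D D' × Oriented true D')
  orient-out D ni with OnG.orient D bridge
  ... | inj₁ d = return (D , OnG.markov-refl D , d)
  ... | inj₂ d = reorient-bridge D d ni

  CoverB : ℕ → DAG G → Set₁
  CoverB i D = (Σ (IndexB i) λ c → RealisesB i c D) ⊎
      (Σ ℕ λ i' → i ≡ suc i' × Σ (IndexB-bridge i') λ c → RealisesD (descB-bridge i' c) D)

  coverB-out : ∀ i (D : DAG G) → CountedB i D → Oriented true D → ¬ ¬ (CoverB i D)
  coverB-out i D prof d = OnG₁.profile-exists (restrict₁ D) n1 >>= λ { (i' , prof1) →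
    ¬¬-⊎¬ (Σ (Fin n) λ y → Arc₂ (restrict₂ D) y r₂) >>= λ
    { (inj₁ yy) → undirected-relate D d yy >>= λ rel →
        withPar i' (countFin-unique (proj₂ (proj₂ prof1)) (proj₂ (proj₂ prof)) (λ x → proj₁ (rel x)) (λ x → proj₂ (rel x)))
            prof1 yy
    ; (inj₂ np) → undirected-relate-bridge D d (λ a ar → np (a , ar)) ni >>= λ rel →
        let n2 : ¬ IntoR G₂ r₂ (restrict₂ D)
            n2 = λ ii → np (intoR⇒parent₂ (restrict₂ D) ii)
            (k1 , m1) = prof₁-cover i' (restrict₁ D) prof1
            (k2 , m2) = free₂-cover (restrict₂ D) n2
            eq = countFin-unique (countFin-insert (proj₂ (proj₂ prof1)) (r₂-not-undirected₁ (restrict₁ D)))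
                (proj₂ (proj₂ prof))
                (λ x → proj₁ (rel x)) (λ x → proj₂ (rel x))
        in return (inj₂ (i' , sym eq , (k1 , k2) , ((λ ()) , (λ _ ())) , realises m1 tt m2 (λ a ar → np (a , ar)) d)) } }
    where
    ni : ¬ IntoR G r₁ D
    ni = proj₁ prof
    n1 : ¬ IntoR G₁ r₁ (restrict₁ D)
    n1 = ¬intoR⇒¬intoR₁ D ni
    withPar : ∀ i' → i' ≡ i → ProfileAt G₁ r₁ i' (restrict₁ D) → Σ (Fin n) (λ y → Arc₂ (restrict₂ D) y r₂) → ¬ ¬ (CoverB i D)
    withPar .i refl prof1 (y , yr) = let (k1 , m1) = prof₁-cover i (restrict₁ D) prof1 in
      ¬¬-⊎¬ (IntoR G₂ r₂ (restrict₂ D)) >>= λ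
      { (inj₁ y2) → let (k2 , m2) = into₂-cover (restrict₂ D) y2 in
          return (inj₁ ((k1 , inj₁ k2) , ((λ ()) , (λ _ _ → into₂-intoR k2)) , realises m1 tt m2 tt d))
      ; (inj₂ n2) → OnG₂.profile-exists (restrict₂ D) n2 >>= λ { (j , prof2) →
          let (k2 , m2) = prof₂-cover j (restrict₂ D) prof2 in
          parent-index₂ D j k2 m2 n2 yr >>= λ { (t , q) →
          let (s , h) = specUpTo-intro IndexB₂ (RealisesBⱼ i k1) δ₂ j (profile₂-bound (restrict₂ D) prof2) (t , k2) D
                          (((λ ()) , (λ _ ())) , realises m1 tt m2 q d)
          in return (inj₁ ((k1 , inj₂ s) , h)) } } }

  coverB : ∀ i (D : DAG G) → CountedB i D → ¬ ¬ (Σ (DAG G) λ D' → MarkovEq G D D' × CoverB i D')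
  coverB i D prof = orient-out D (proj₁ prof) >>= λ { (D' , e , d') →
    coverB-out i D' (OnG.profile-markov D D' e prof) d' >>= λ cv → return (D' , e , cv) }

  realisesB-markov : ∀ i c (D D' : DAG G) → RealisesB i c D → RealisesB i c D' → ¬ ¬ (MarkovEq G D D')
  realisesB-markov i (k1 , inj₁ k2) D D' h h' = realisesD-markov (descB₁ i k1 k2) D D' h h'
  realisesB-markov i (k1 , inj₂ s) D D' h h' = specUpTo-markov IndexB₂ (RealisesBⱼ i k1)
      (λ j x → realisesD-markov (descBⱼ i k1 j x)) δ₂ s D D' h h'

  IndexB↔ : ∀ i → Fin (b₁ i * (a₂ + sumTo δ₂ (λ j → j * b₂ j))) ↔ IndexB i
  IndexB↔ i = ↔-trans (*↔× {b₁ i}) (↔-refl ×-↔ ↔-trans (+↔⊎ {a₂})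
              (↔-refl ⊎-↔ Fin-sumTo↔SumUpTo δ₂ _ IndexB₂ (λ j → *↔× {j} {b₂ j})))

  formulaB₀ : ∀ (B0 : ℕ) → N0i G r₁ 0 B0 → ¬ ¬ (B0 ≡ b₁ 0 * (a₂ + sumTo δ₂ (λ j → j * b₂ j)))
  formulaB₀ B0 sys = ¬¬-Π-↔ (IndexB↔ 0) (existsB 0) >>= λ tab →
    Classes.countClasses-unique (CountedB 0) B0 sys (IndexB 0) _ (IndexB↔ 0) (λ c → proj₁ (tab c))
        (λ c → proj₂ (proj₂ (tab c)))
      (λ c c' e → injectiveB 0 c c' _ _ (proj₁ (proj₂ (tab c))) (proj₁ (proj₂ (tab c'))) e)
      (λ D p → coverB 0 D p >>= λ
        { (D' , e , inj₁ (c , h)) → realisesB-markov 0 c D' (proj₁ (tab c)) h (proj₁ (proj₂ (tab c))) >>= λ e' →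
            return (c , OnG.markov-trans D D' (proj₁ (tab c)) e e')
        ; (D' , e , inj₂ (i' , () , _)) })

  IndexB⁺ : ℕ → Set
  IndexB⁺ i' = IndexB (suc i') ⊎ IndexB-bridge i'

  RealisesB⁺ : ∀ i' → IndexB⁺ i' → DAG G → Set₁
  RealisesB⁺ i' (inj₁ c) D = RealisesB (suc i') c D
  RealisesB⁺ i' (inj₂ c) D = RealisesD (descB-bridge i' c) D

  formulaB : ∀ i' (Bi : ℕ) → N0i G r₁ (suc i') Bi →
    ¬ ¬ (Bi ≡ b₁ (suc i') * (a₂ + sumTo δ₂ (λ j → j * b₂ j)) + b₁ (suc i' ∸ 1) * c₂)
  formulaB i' Bi sys = ¬¬-Π-↔ iso ex >>= λ tab →
    Classes.countClasses-unique (CountedB (suc i')) Bi sys (IndexB⁺ i') _ iso (λ c → proj₁ (tab c))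
        (λ c → proj₂ (proj₂ (tab c)))
      (λ c c' e → inj c c' _ _ (proj₁ (proj₂ (tab c))) (proj₁ (proj₂ (tab c'))) e)
      (λ D p → coverB (suc i') D p >>= λ
        { (D' , e , inj₁ (c , h)) → realisesB-markov (suc i') c D' (proj₁ (tab (inj₁ c))) h (proj₁ (proj₂ (tab (inj₁ c))))
              >>= λ e' →
            return (inj₁ c , OnG.markov-trans D D' (proj₁ (tab (inj₁ c))) e e')
        ; (D' , e , inj₂ (.i' , refl , c , h)) → realisesD-markov (descB-bridge i' c) D' (proj₁ (tab (inj₂ c))) h
            (proj₁ (proj₂ (tab (inj₂ c)))) >>=
            λ e' →
            return (inj₂ c , OnG.markov-trans D D' (proj₁ (tab (inj₂ c))) e e') })
    where
    iso : Fin (b₁ (suc i') * (a₂ + sumTo δ₂ (λ j → j * b₂ j)) + b₁ (suc i' ∸ 1) * c₂) ↔ IndexB⁺ i'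
    iso = ↔-trans +↔⊎ (IndexB↔ (suc i') ⊎-↔ *↔× {b₁ i'} {c₂})
    ex : ∀ c → ¬ ¬ (Σ (DAG G) λ D → RealisesB⁺ i' c D × CountedB (suc i') D)
    ex (inj₁ c) = existsB (suc i') c
    ex (inj₂ c) = existsB-bridge i' c
    inj : ∀ c c' (D D' : DAG G) → RealisesB⁺ i' c D → RealisesB⁺ i' c' D' → MarkovEq G D D' → c ≡ c'
    inj (inj₁ c) (inj₁ c') D D' h h' e = cong inj₁ (injectiveB (suc i') c c' D D' h h' e)
    inj (inj₂ c) (inj₂ c') D D' h h' e = cong inj₂ (injectiveB-bridge i' c c' D D' h h' e)
    inj (inj₁ c) (inj₂ c') D D' h h' e = ⊥-elim (B≉B-bridge i' c c' D D' h h' e)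
    inj (inj₂ c) (inj₁ c') D D' h h' e = ⊥-elim (B≉B-bridge i' c' c D' D h' h (OnG.markov-sym D D' e))

mainTheorem4 : ∀ {n} (G : Graph n) (r₁ r₂ : Fin n) →
    IsTree G → E G r₁ r₂ →
    ∀ (δ δ₂ : ℕ) → Degree G r₁ δ → Degree (component G r₂ r₁) r₂ δ₂ →
    ∀ (A : ℕ) (B : ℕ → ℕ) (a₁ : ℕ) (b₁ : ℕ → ℕ) (a₂ c₂ : ℕ) (b₂ : ℕ → ℕ) →
    N1 G r₁ A → (∀ i → N0i G r₁ i (B i)) →
    N1 (component G r₁ r₂) r₁ a₁ → (∀ i → N0i (component G r₁ r₂) r₁ i (b₁ i)) →
    N1 (component G r₂ r₁) r₂ a₂ → N0 (component G r₂ r₁) r₂ c₂ →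
    (∀ j → N0i (component G r₂ r₁) r₂ j (b₂ j)) →
    (A ≡ a₁ * (2 * a₂ + sumTo δ₂ (λ j → (j + 2) * b₂ j))
           + sumTo (δ ∸ 1) (λ i → b₁ i * ((i + 1) * a₂ + i * c₂)))
    × (B 0 ≡ b₁ 0 * (a₂ + sumTo δ₂ (λ j → j * b₂ j)))
    × (∀ i → 1 ≤ i → i ≤ δ →
         B i ≡ b₁ i * (a₂ + sumTo δ₂ (λ j → j * b₂ j)) + b₁ (i ∸ 1) * c₂)
mainTheorem4 G r₁ r₂ T bridge δ δ₂ deg deg₂ A B a₁ b₁ a₂ c₂ b₂ sA sB sysA₁ sysB₁ sysA₂ sysC₂ sysB₂ =
  decidable-stable (A ≟ℕ _) (F.formulaA A sA) ,
  decidable-stable (B 0 ≟ℕ _) (F.formulaB₀ (B 0) (sB 0)) ,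
  formula3
  where
  module F = Formulas G r₁ r₂ T bridge δ δ₂ deg deg₂ a₁ b₁ a₂ c₂ b₂ sysA₁ sysB₁ sysA₂ sysC₂ sysB₂
  formula3 : ∀ i → 1 ≤ i → i ≤ δ → B i ≡ b₁ i * (a₂ + sumTo δ₂ (λ j → j * b₂ j)) + b₁ (i ∸ 1) * c₂
  formula3 (suc i) (s≤s z≤n) _ = decidable-stable (B (suc i) ≟ℕ _) (F.formulaB i (B (suc i)) (sB (suc i)))
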